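{- Let $A=\mathbb{F}_q[t]$, where $q$ is a power of a prime $p$. Let $\wp\in A$ be a monic irreducible polynomial of degree $d$, and let $\theta\in\mathbb{F}_{q^d}$ be a root of $\wp$. Let $a\in A$. The following conditions are equivalent: (0) $\wp$ is $a$-Wieferich, i.e. $a^{q^d}\equiv a \pmod{\wp^2}$; (i) $da/dt\equiv 0\pmod{\wp}$; (i') $(da/dt)|_{t=\theta}=0$; (ii) $Q_{\wp}(a)\equiv 0\pmod{\wp}$; (ii') $Q_{\wp}(a)|_{t=\theta}=0$; (iii) $a^{[1]}|_{t=\theta}=0$.
   Context: For $a\in\mathbb{F}_{q^d}[t]$ (with $t$ an indeterminate), the Fermat quotient is $Q_{\wp}(a):=(a^{q^d}-a)/\wp\in\mathbb{F}_{q^d}[t]$ (this is a polynomial since $\wp$ divides $t^{q^d}-t$), and the difference quotient is $a^{[1]}(t):=(a(t)-a(\theta))/(t-\theta)\in\mathbb{F}_{q^d}[t]$. Congruences modulo $\wp$ are divisibility statements in $\mathbb{F}_{q^d}[t]$ (for elements of $A$, equivalently in $A$). -}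

module Defs where

open import Level using (0ℓ)
open import Data.Nat using (ℕ; zero; suc; _<_; _^_)
open import Data.Nat.Primality using (Prime)
open import Data.Fin using (Fin)
open import Data.List using (List; []; _∷_; map)
open import Data.Product using (Σ; _×_)
open import Data.Sum using (_⊎_)
open import Relation.Nullary using (¬_)
open import Relation.Binary.PropositionalEquality using (_≡_)
open import Function.Bundles using (_⇔_)
open import Algebra.Bundles using (CommutativeRing)
open import Algebra.Morphism.Structures using (module RingMorphisms)

-- Polynomials in one indeterminate t over a commutative ring R,
-- represented as coefficient lists (constant coefficient first).
-- Equality of polynomials is coefficientwise (so trailing zeros are
-- irrelevant).

module Poly (R : CommutativeRing 0ℓ 0ℓ) where
  open CommutativeRing R

  Pol : Set
  Pol = List Carrier

  coeff : Pol → ℕ → Carrier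
  coeff []      n       = 0#
  coeff (c ∷ p) zero    = c
  coeff (c ∷ p) (suc n) = coeff p n

  infix 4 _≈P_
  _≈P_ : Pol → Pol → Set
  p ≈P q = ∀ n → coeff p n ≈ coeff q n

  infixl 6 _+P_ _-P_
  infixl 7 _*P_
  infixr 8 _^P_

  _+P_ : Pol → Pol → Pol
  []      +P q       = q
  (a ∷ p) +P []      = a ∷ p
  (a ∷ p) +P (b ∷ q) = (a + b) ∷ (p +P q)

  -P_ : Pol → Pol
  -P p = map -_ p

  _-P_ : Pol → Pol → Pol
  p -P q = p +P (-P q)

  scaleP : Carrier → Pol → Pol
  scaleP c p = map (c *_) p

  _*P_ : Pol → Pol → Pol
  []      *P q = []
  (a ∷ p) *P q = scaleP a q +P (0# ∷ (p *P q))

  constP : Carrier → Pol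
  constP c = c ∷ []

  oneP : Pol
  oneP = constP 1#

  tP : Pol
  tP = 0# ∷ 1# ∷ []

  _^P_ : Pol → ℕ → Pol
  p ^P zero  = oneP
  p ^P suc n = p *P (p ^P n)

  eval : Pol → Carrier → Carrier
  eval []      x = 0#
  eval (c ∷ p) x = c + x * eval p x

  natMul : ℕ → Carrier → Carrier
  natMul zero    c = 0#
  natMul (suc n) c = c + natMul n c

  derivAux : ℕ → Pol → Pol
  derivAux k []      = []
  derivAux k (c ∷ p) = natMul k c ∷ derivAux (suc k) p

  deriv : Pol → Pol
  deriv []      = []
  deriv (c ∷ p) = derivAux 1 p

  infix 4 _∣P_
  _∣P_ : Pol → Pol → Set
  f ∣P g = Σ Pol (λ h → f *P h ≈P g)

  IsUnitP : Pol → Set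
  IsUnitP p = Σ Pol (λ u → p *P u ≈P oneP)

  MonicOfDegree : ℕ → Pol → Set
  MonicOfDegree d p = (coeff p d ≈ 1#) × (∀ n → d < n → coeff p n ≈ 0#)

  Irreducible : Pol → Set
  Irreducible p = (¬ (p ≈P [])) × (¬ IsUnitP p)
                × (∀ g h → g *P h ≈P p → IsUnitP g ⊎ IsUnitP h)

record FiniteField (n : ℕ) : Set₁ where
  field
    ring : CommutativeRing 0ℓ 0ℓ
  open CommutativeRing ring
  field
    0≉1      : ¬ (0# ≈ 1#)
    inverse  : ∀ x → ¬ (x ≈ 0#) → Σ Carrier (λ y → x * y ≈ 1#)
    enum     : Fin n → Carrier
    enum-inj : ∀ i j → enum i ≈ enum j → i ≡ j
    enum-sur : ∀ x → Σ (Fin n) (λ i → enum i ≈ x)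

module Setting (q d : ℕ) (K : FiniteField q) (L : FiniteField (q ^ d))
               (ι : CommutativeRing.Carrier (FiniteField.ring K)
                  → CommutativeRing.Carrier (FiniteField.ring L))
               (℘ : List (CommutativeRing.Carrier (FiniteField.ring K)))
               (θ : CommutativeRing.Carrier (FiniteField.ring L))
               (a : List (CommutativeRing.Carrier (FiniteField.ring K))) where
  module KR = CommutativeRing (FiniteField.ring K)
  module LR = CommutativeRing (FiniteField.ring L)
  module A  = Poly (FiniteField.ring K)
  module B  = Poly (FiniteField.ring L)

  ιP : A.Pol → B.Pol
  ιP = map ι

  at-θ : A.Pol → LR.Carrier
  at-θ f = B.eval (ιP f) θ

  Cond0 : Set
  Cond0 = (℘ A.*P ℘) A.∣P (a A.^P (q ^ d) A.-P a)

  Cond-i : Set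
  Cond-i = ℘ A.∣P A.deriv a

  Cond-i' : Set
  Cond-i' = at-θ (A.deriv a) LR.≈ LR.0#

  IsFermatQuotient : A.Pol → Set
  IsFermatQuotient Q = ℘ A.*P Q A.≈P (a A.^P (q ^ d) A.-P a)

  Cond-ii : Set
  Cond-ii = ∀ Q → IsFermatQuotient Q → ℘ A.∣P Q

  Cond-ii' : Set
  Cond-ii' = ∀ Q → IsFermatQuotient Q → at-θ Q LR.≈ LR.0#

  IsDiffQuotient : B.Pol → Set
  IsDiffQuotient a1 =
    (B.tP B.-P B.constP θ) B.*P a1 B.≈P (ιP a B.-P B.constP (at-θ a))

  Cond-iii : Set
  Cond-iii = ∀ a1 → IsDiffQuotient a1 → B.eval a1 θ LR.≈ LR.0#

  AllEquivalent : Set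
  AllEquivalent = (Cond0 ⇔ Cond-i) × (Cond0 ⇔ Cond-i') × (Cond0 ⇔ Cond-ii)
                × (Cond0 ⇔ Cond-ii') × (Cond0 ⇔ Cond-iii)

IsRingHom : ∀ {m n} (K : FiniteField m) (L : FiniteField n)
          → (CommutativeRing.Carrier (FiniteField.ring K)
             → CommutativeRing.Carrier (FiniteField.ring L)) → Set
IsRingHom K L ι = RingMorphisms.IsRingHomomorphism
  (CommutativeRing.rawRing (FiniteField.ring K))
  (CommutativeRing.rawRing (FiniteField.ring L)) ι

{-# OPTIONS --safe #-}
-- Put F = a ^ q^d - a. As θ is a root of the irreducible ℘, a polynomial over F_q is divisible
-- by ℘ exactly when it vanishes at θ (run Euclid's algorithm on ℘ and f). Since x ^ q^d = x on
-- F_{q^d}, this gives F = ℘ Q and t ^ q^d - t = g ℘. The derivative of a (q^d)-th power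
-- vanishes in characteristic p, so differentiating yields ℘' Q + ℘ Q' = - a' and
-- g' ℘ + g ℘' = -1. The first identity shows ℘ ∣ Q ⇒ ℘ ∣ a'; multiplying the second by Q
-- shows Q ≡ g a' (mod ℘), whence ℘ ∣ a' ⇒ ℘ ∣ Q. Condition (0) is ℘ ∣ Q, the primed
-- conditions are the unprimed ones read at θ, and differentiating (t - θ) a^[1] = a - a(θ)
-- shows a^[1](θ) = a'(θ).

module Submission where

open import Defs
open import Data.Nat using (ℕ; _^_)
open import Data.Nat.Primality using (Prime)
open import Data.List using (List; map)
open import Relation.Binary.PropositionalEquality using (_≡_)
open import Algebra.Bundles using (CommutativeRing)
open import Level using (0ℓ)
open import Data.Nat as ℕ using (zero; suc)
import Data.Nat.Properties as ℕₚ
open import Data.List using ([]; _∷_)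
open import Data.Product using (Σ; _,_; proj₁; proj₂)
open import Data.Sum using (inj₁; inj₂)
open import Data.Empty using (⊥-elim)
open import Data.Fin as Fin using (Fin; punchIn)
open import Data.Fin.Properties using (punchInᵢ≢i)
open import Data.Fin.Permutation using (Permutation; permutation)
open import Data.Vec.Functional using (replicate; removeAt)
open import Relation.Nullary using (¬_; Dec; yes; no)
open import Relation.Binary.Bundles using (Setoid)
open import Relation.Binary.PropositionalEquality using (_≢_)
import Relation.Binary.PropositionalEquality as ≡
import Relation.Binary.Reasoning.Setoid
open import Function.Bundles using (_⇔_; mk⇔)
open import Function.Properties.Equivalence using () renaming (trans to ⇔-trans)
open import Algebra.Bundles using (CommutativeMonoid)
open import Algebra.Morphism.Structures using (module RingMorphisms)
import Algebra.Properties.Semiring.Mult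
import Algebra.Properties.CommutativeMonoid.Sum

-- Integer (not ring-element) coefficients, so that cancellations such as x - x = 0 are decided.
module IntegerCoefficientSolver {c ℓ} (R : CommutativeRing c ℓ) where
  open import Data.Integer as ℤ using (ℤ; +_; -[1+_]; _⊖_; ∣_∣; sign; _◃_)
  open import Data.Integer.Properties using ([1+m]⊖[1+n]≡m⊖n; ◃-inverse)
  open import Data.Sign as Sign using (Sign)
  open import Data.Maybe using (Maybe; just; nothing)
  open import Algebra.Solver.Ring.AlmostCommutativeRing using (fromCommutativeRing; _-Raw-AlmostCommutative⟶_)
  open CommutativeRing R
  open import Algebra.Properties.Ring ring using (-0#≈0#; -‿involutive; -‿distribˡ-*; -‿+-comm)
  open import Algebra.Properties.Semiring.Mult semiring using (_×_; ×-homo-+; ×1-homo-*)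
  open import Algebra.Properties.CommutativeSemigroup +-commutativeSemigroup
    using () renaming (interchange to +-interchange)
  open import Algebra.Properties.CommutativeSemigroup *-commutativeSemigroup
    using () renaming (interchange to *-interchange)
  open import Relation.Binary.Reasoning.Setoid setoid

  fromℤ : ℤ → Carrier
  fromℤ (+ n)    = n × 1#
  fromℤ -[1+ n ] = - (suc n × 1#)

  private
    sign-val : Sign → Carrier
    sign-val Sign.+ = 1#
    sign-val Sign.- = - 1#

    sign-val-* : ∀ s t → sign-val (s Sign.* t) ≈ sign-val s * sign-val t
    sign-val-* Sign.- Sign.- = sym (trans (sym (-‿distribˡ-* 1# (- 1#)))
                                   (trans (-‿cong (*-identityˡ _)) (-‿involutive _)))
    sign-val-* Sign.- Sign.+ = sym (*-identityʳ _)
    sign-val-* Sign.+ Sign.- = sym (*-identityˡ _)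
    sign-val-* Sign.+ Sign.+ = sym (*-identityˡ _)

    fromℤ-◃ : ∀ s n → fromℤ (s ◃ n) ≈ sign-val s * (n × 1#)
    fromℤ-◃ s      zero    = sym (zeroʳ _)
    fromℤ-◃ Sign.+ (suc n) = sym (*-identityˡ _)
    fromℤ-◃ Sign.- (suc n) = trans (-‿cong (sym (*-identityˡ _))) (-‿distribˡ-* _ _)

    fromℤ-sign : ∀ i → fromℤ i ≈ sign-val (sign i) * (∣ i ∣ × 1#)
    fromℤ-sign i = trans (reflexive (≡.cong fromℤ (≡.sym (◃-inverse i)))) (fromℤ-◃ (sign i) ∣ i ∣)

    [1+x]-[1+y]≈x-y : ∀ x y → (1# + x) - (1# + y) ≈ x - y
    [1+x]-[1+y]≈x-y x y = begin
      (1# + x) - (1# + y)      ≈⟨ +-congˡ (-‿+-comm 1# y) ⟨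
      (1# + x) + (- 1# + - y)  ≈⟨ +-interchange 1# x (- 1#) (- y) ⟩
      (1# - 1#) + (x - y)      ≈⟨ +-congʳ (-‿inverseʳ 1#) ⟩
      0# + (x - y)             ≈⟨ +-identityˡ _ ⟩
      x - y                    ∎

  fromℤ-⊖ : ∀ m n → fromℤ (m ⊖ n) ≈ m × 1# - n × 1#
  fromℤ-⊖ m       zero    = sym (trans (+-congˡ -0#≈0#) (+-identityʳ _))
  fromℤ-⊖ zero    (suc n) = sym (+-identityˡ _)
  fromℤ-⊖ (suc m) (suc n) = begin
    fromℤ (suc m ⊖ suc n)    ≡⟨ ≡.cong fromℤ ([1+m]⊖[1+n]≡m⊖n m n) ⟩
    fromℤ (m ⊖ n)            ≈⟨ fromℤ-⊖ m n ⟩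
    m × 1# - n × 1#          ≈⟨ [1+x]-[1+y]≈x-y _ _ ⟨
    suc m × 1# - suc n × 1#  ∎

  fromℤ-+ : ∀ i j → fromℤ (i ℤ.+ j) ≈ fromℤ i + fromℤ j
  fromℤ-+ -[1+ m ] -[1+ n ] = begin
    - (suc (suc (m ℕ.+ n)) × 1#)       ≡⟨ ≡.cong (λ k → - (suc k × 1#)) (ℕₚ.+-suc m n) ⟨
    - ((suc m ℕ.+ suc n) × 1#)         ≈⟨ -‿cong (×-homo-+ 1# (suc m) (suc n)) ⟩
    - (suc m × 1# + suc n × 1#)        ≈⟨ -‿+-comm _ _ ⟨
    - (suc m × 1#) + - (suc n × 1#)    ∎
  fromℤ-+ -[1+ m ] (+ n)    = trans (fromℤ-⊖ n (suc m)) (+-comm _ _)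
  fromℤ-+ (+ m)    -[1+ n ] = fromℤ-⊖ m (suc n)
  fromℤ-+ (+ m)    (+ n)    = ×-homo-+ 1# m n

  fromℤ-* : ∀ i j → fromℤ (i ℤ.* j) ≈ fromℤ i * fromℤ j
  fromℤ-* i j = begin
    fromℤ (i ℤ.* j)
      ≈⟨ fromℤ-◃ (sign i Sign.* sign j) (∣ i ∣ ℕ.* ∣ j ∣) ⟩
    sign-val (sign i Sign.* sign j) * ((∣ i ∣ ℕ.* ∣ j ∣) × 1#)
      ≈⟨ *-cong (sign-val-* (sign i) (sign j)) (×1-homo-* ∣ i ∣ ∣ j ∣) ⟩
    (sign-val (sign i) * sign-val (sign j)) * ((∣ i ∣ × 1#) * (∣ j ∣ × 1#))
      ≈⟨ *-interchange _ _ _ _ ⟩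
    (sign-val (sign i) * (∣ i ∣ × 1#)) * (sign-val (sign j) * (∣ j ∣ × 1#))
      ≈⟨ *-cong (fromℤ-sign i) (fromℤ-sign j) ⟨
    fromℤ i * fromℤ j
      ∎

  fromℤ-neg : ∀ i → fromℤ (ℤ.- i) ≈ - fromℤ i
  fromℤ-neg (+ zero)  = sym -0#≈0#
  fromℤ-neg (+ suc n) = refl
  fromℤ-neg -[1+ n ]  = sym (-‿involutive _)

  fromℤ-homomorphism : ℤ.+-*-rawRing -Raw-AlmostCommutative⟶ fromCommutativeRing R
  fromℤ-homomorphism = record
    { ⟦_⟧ = fromℤ ; +-homo = fromℤ-+ ; *-homo = fromℤ-* ; -‿homo = fromℤ-neg
    ; 0-homo = refl ; 1-homo = +-identityʳ 1# }

  private
    fromℤ-≟ : ∀ i j → Maybe (fromℤ i ≈ fromℤ j)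
    fromℤ-≟ i j with i ℤ.≟ j
    ... | yes ≡.refl = just refl
    ... | no _       = nothing

  open import Algebra.Solver.Ring ℤ.+-*-rawRing (fromCommutativeRing R) fromℤ-homomorphism fromℤ-≟ public

module Polynomials (R : CommutativeRing 0ℓ 0ℓ) where
  open CommutativeRing R hiding (zero)
  open Poly R
  open import Algebra.Properties.Ring ring using (-0#≈0#; -‿+-comm)
  open import Algebra.Properties.CommutativeSemigroup +-commutativeSemigroup
    using () renaming (interchange to +-interchange)
  module ≈-Reasoning = Relation.Binary.Reasoning.Setoid setoid

  -- A record around _≈P_, so that both polynomials can be inferred from an equation.
  infix 4 _≋_
  record _≋_ (p q : Pol) : Set where
    constructor coeffwise
    field coeff-≈ : p ≈P q
  open _≋_ public

  ≋-refl : ∀ {p} → p ≋ p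
  ≋-refl = coeffwise λ _ → refl

  ≋-sym : ∀ {p q} → p ≋ q → q ≋ p
  ≋-sym (coeffwise e) = coeffwise λ n → sym (e n)

  ≋-trans : ∀ {p q r} → p ≋ q → q ≋ r → p ≋ r
  ≋-trans (coeffwise e) (coeffwise f) = coeffwise λ n → trans (e n) (f n)

  ≋-setoid : Setoid 0ℓ 0ℓ
  ≋-setoid = record
    { Carrier = Pol ; _≈_ = _≋_
    ; isEquivalence = record { refl = ≋-refl ; sym = ≋-sym ; trans = ≋-trans } }

  module ≋-Reasoning = Relation.Binary.Reasoning.Setoid ≋-setoid

  ∷-cong : ∀ {a b p q} → a ≈ b → p ≋ q → (a ∷ p) ≋ (b ∷ q)
  ∷-cong a≈b (coeffwise p≈q) = coeffwise λ { zero → a≈b ; (suc n) → p≈q n }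

  ∷-injectiveˡ : ∀ {a b p q} → (a ∷ p) ≋ (b ∷ q) → a ≈ b
  ∷-injectiveˡ (coeffwise e) = e zero

  ∷-injectiveʳ : ∀ {a b p q} → (a ∷ p) ≋ (b ∷ q) → p ≋ q
  ∷-injectiveʳ (coeffwise e) = coeffwise λ n → e (suc n)

  ∷≋0 : ∀ {a p} → a ≈ 0# → p ≋ [] → (a ∷ p) ≋ []
  ∷≋0 a≈0 (coeffwise p≈0) = coeffwise λ { zero → a≈0 ; (suc n) → p≈0 n }

  ∷≋0⇒head≈0 : ∀ {a p} → (a ∷ p) ≋ [] → a ≈ 0#
  ∷≋0⇒head≈0 (coeffwise e) = e zero

  ∷≋0⇒tail≋0 : ∀ {a p} → (a ∷ p) ≋ [] → p ≋ []
  ∷≋0⇒tail≋0 (coeffwise e) = coeffwise λ n → e (suc n)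

  coeff-+P : ∀ p q n → coeff (p +P q) n ≈ coeff p n + coeff q n
  coeff-+P []      q       n       = sym (+-identityˡ _)
  coeff-+P (a ∷ p) []      n       = sym (+-identityʳ _)
  coeff-+P (a ∷ p) (b ∷ q) zero    = refl
  coeff-+P (a ∷ p) (b ∷ q) (suc n) = coeff-+P p q n

  coeff--P : ∀ p n → coeff (-P p) n ≈ - coeff p n
  coeff--P []      n       = sym -0#≈0#
  coeff--P (a ∷ p) zero    = refl
  coeff--P (a ∷ p) (suc n) = coeff--P p n

  coeff-scaleP : ∀ c p n → coeff (scaleP c p) n ≈ c * coeff p n
  coeff-scaleP c []      n       = sym (zeroʳ c)
  coeff-scaleP c (a ∷ p) zero    = refl
  coeff-scaleP c (a ∷ p) (suc n) = coeff-scaleP c p n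

  +P-cong : ∀ {p p' q q'} → p ≋ p' → q ≋ q' → p +P q ≋ p' +P q'
  +P-cong {p} {p'} {q} {q'} (coeffwise e) (coeffwise f) = coeffwise λ n → begin
    coeff (p +P q) n        ≈⟨ coeff-+P p q n ⟩
    coeff p n + coeff q n   ≈⟨ +-cong (e n) (f n) ⟩
    coeff p' n + coeff q' n ≈⟨ coeff-+P p' q' n ⟨
    coeff (p' +P q') n      ∎
    where
    open ≈-Reasoning

  +P-comm : ∀ p q → p +P q ≋ q +P p
  +P-comm p q = coeffwise λ n →
    trans (coeff-+P p q n) (trans (+-comm _ _) (sym (coeff-+P q p n)))

  +P-assoc : ∀ p q r → (p +P q) +P r ≋ p +P (q +P r)
  +P-assoc p q r = coeffwise λ n → begin
    coeff ((p +P q) +P r) n               ≈⟨ coeff-+P (p +P q) r n ⟩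
    coeff (p +P q) n + coeff r n          ≈⟨ +-congʳ (coeff-+P p q n) ⟩
    (coeff p n + coeff q n) + coeff r n   ≈⟨ +-assoc _ _ _ ⟩
    coeff p n + (coeff q n + coeff r n)   ≈⟨ +-congˡ (coeff-+P q r n) ⟨
    coeff p n + coeff (q +P r) n          ≈⟨ coeff-+P p (q +P r) n ⟨
    coeff (p +P (q +P r)) n               ∎
    where
    open ≈-Reasoning

  +P-interchange : ∀ w x y z → (w +P x) +P (y +P z) ≋ (w +P y) +P (x +P z)
  +P-interchange w x y z = coeffwise λ n → begin
    coeff ((w +P x) +P (y +P z)) n                        ≈⟨ expand w x y z n ⟩
    (coeff w n + coeff x n) + (coeff y n + coeff z n)     ≈⟨ +-interchange _ _ _ _ ⟩
    (coeff w n + coeff y n) + (coeff x n + coeff z n)     ≈⟨ expand w y x z n ⟨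
    coeff ((w +P y) +P (x +P z)) n                        ∎
    where
    open ≈-Reasoning
    expand : ∀ w x y z n →
      coeff ((w +P x) +P (y +P z)) n ≈ (coeff w n + coeff x n) + (coeff y n + coeff z n)
    expand w x y z n =
      trans (coeff-+P (w +P x) (y +P z) n) (+-cong (coeff-+P w x n) (coeff-+P y z n))

  +P-identityʳ : ∀ p → p +P [] ≋ p
  +P-identityʳ p = coeffwise λ n → trans (coeff-+P p [] n) (+-identityʳ _)

  -P-inverseˡ : ∀ p → (-P p) +P p ≋ []
  -P-inverseˡ p = coeffwise λ n →
    trans (coeff-+P (-P p) p n) (trans (+-congʳ (coeff--P p n)) (-‿inverseˡ _))

  -P-inverseʳ : ∀ p → p +P (-P p) ≋ []
  -P-inverseʳ p = ≋-trans (+P-comm p (-P p)) (-P-inverseˡ p)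

  -P-cong : ∀ {p q} → p ≋ q → -P p ≋ -P q
  -P-cong {p} {q} (coeffwise e) = coeffwise λ n →
    trans (coeff--P p n) (trans (-‿cong (e n)) (sym (coeff--P q n)))

  scaleP-cong : ∀ {c d p q} → c ≈ d → p ≋ q → scaleP c p ≋ scaleP d q
  scaleP-cong {c} {d} {p} {q} c≈d (coeffwise e) = coeffwise λ n →
    trans (coeff-scaleP c p n) (trans (*-cong c≈d (e n)) (sym (coeff-scaleP d q n)))

  scaleP-distribˡ : ∀ c p q → scaleP c (p +P q) ≋ scaleP c p +P scaleP c q
  scaleP-distribˡ c p q = coeffwise λ n → begin
    coeff (scaleP c (p +P q)) n                  ≈⟨ coeff-scaleP c (p +P q) n ⟩
    c * coeff (p +P q) n                         ≈⟨ *-congˡ (coeff-+P p q n) ⟩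
    c * (coeff p n + coeff q n)                  ≈⟨ distribˡ _ _ _ ⟩
    c * coeff p n + c * coeff q n                ≈⟨ +-cong (coeff-scaleP c p n) (coeff-scaleP c q n) ⟨
    coeff (scaleP c p) n + coeff (scaleP c q) n  ≈⟨ coeff-+P (scaleP c p) (scaleP c q) n ⟨
    coeff (scaleP c p +P scaleP c q) n           ∎
    where
    open ≈-Reasoning

  scaleP-distribʳ : ∀ c d p → scaleP (c + d) p ≋ scaleP c p +P scaleP d p
  scaleP-distribʳ c d p = coeffwise λ n → begin
    coeff (scaleP (c + d) p) n                   ≈⟨ coeff-scaleP (c + d) p n ⟩
    (c + d) * coeff p n                          ≈⟨ distribʳ _ _ _ ⟩
    c * coeff p n + d * coeff p n                ≈⟨ +-cong (coeff-scaleP c p n) (coeff-scaleP d p n) ⟨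
    coeff (scaleP c p) n + coeff (scaleP d p) n  ≈⟨ coeff-+P (scaleP c p) (scaleP d p) n ⟨
    coeff (scaleP c p +P scaleP d p) n           ∎
    where
    open ≈-Reasoning

  scaleP-assoc : ∀ c d p → scaleP c (scaleP d p) ≋ scaleP (c * d) p
  scaleP-assoc c d p = coeffwise λ n → begin
    coeff (scaleP c (scaleP d p)) n  ≈⟨ coeff-scaleP c (scaleP d p) n ⟩
    c * coeff (scaleP d p) n         ≈⟨ *-congˡ (coeff-scaleP d p n) ⟩
    c * (d * coeff p n)              ≈⟨ *-assoc _ _ _ ⟨
    (c * d) * coeff p n              ≈⟨ coeff-scaleP (c * d) p n ⟨
    coeff (scaleP (c * d) p) n       ∎
    where
    open ≈-Reasoning

  scaleP-identity : ∀ p → scaleP 1# p ≋ p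
  scaleP-identity p = coeffwise λ n → trans (coeff-scaleP 1# p n) (*-identityˡ _)

  scaleP-zero : ∀ {c} p → c ≈ 0# → scaleP c p ≋ []
  scaleP-zero {c} p c≈0 = coeffwise λ n →
    trans (coeff-scaleP c p n) (trans (*-congʳ c≈0) (zeroˡ _))

  *P-congʳ : ∀ p {q q'} → q ≋ q' → p *P q ≋ p *P q'
  *P-congʳ []      q≈q' = ≋-refl
  *P-congʳ (a ∷ p) q≈q' = +P-cong (scaleP-cong refl q≈q') (∷-cong refl (*P-congʳ p q≈q'))

  *P-zeroˡ : ∀ {p} q → p ≋ [] → p *P q ≋ []
  *P-zeroˡ {[]}    q p≈0 = ≋-refl
  *P-zeroˡ {a ∷ p} q p≈0 =
    +P-cong (scaleP-zero q (∷≋0⇒head≈0 p≈0)) (∷≋0 refl (*P-zeroˡ q (∷≋0⇒tail≋0 p≈0)))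

  *P-zeroʳ : ∀ p → p *P [] ≋ []
  *P-zeroʳ []      = ≋-refl
  *P-zeroʳ (a ∷ p) = ∷≋0 refl (*P-zeroʳ p)

  *P-congˡ : ∀ {p p'} q → p ≋ p' → p *P q ≋ p' *P q
  *P-congˡ {[]}    {p'}     q p≈p' = ≋-sym (*P-zeroˡ q (≋-sym p≈p'))
  *P-congˡ {a ∷ p} {[]}     q p≈p' = *P-zeroˡ q p≈p'
  *P-congˡ {a ∷ p} {b ∷ p'} q p≈p' =
    +P-cong (scaleP-cong (∷-injectiveˡ p≈p') ≋-refl) (∷-cong refl (*P-congˡ q (∷-injectiveʳ p≈p')))

  *P-cong : ∀ {p p' q q'} → p ≋ p' → q ≋ q' → p *P q ≋ p' *P q'
  *P-cong {p' = p'} {q = q} p≈p' q≈q' = ≋-trans (*P-congˡ q p≈p') (*P-congʳ p' q≈q')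

  0∷-+P : ∀ p q → (0# ∷ p) +P (0# ∷ q) ≋ 0# ∷ (p +P q)
  0∷-+P p q = ∷-cong (+-identityˡ 0#) ≋-refl

  0∷-*P : ∀ p q → (0# ∷ p) *P q ≋ 0# ∷ (p *P q)
  0∷-*P p q = +P-cong (scaleP-zero q refl) ≋-refl

  *P-distribʳ : ∀ p p' q → (p +P p') *P q ≋ p *P q +P p' *P q
  *P-distribʳ []      p'       q = ≋-refl
  *P-distribʳ (a ∷ p) []       q = ≋-sym (+P-identityʳ _)
  *P-distribʳ (a ∷ p) (b ∷ p') q = begin
    scaleP (a + b) q +P (0# ∷ (p +P p') *P q)
      ≈⟨ +P-cong (scaleP-distribʳ a b q) (∷-cong refl (*P-distribʳ p p' q)) ⟩
    (scaleP a q +P scaleP b q) +P (0# ∷ (p *P q +P p' *P q))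
      ≈⟨ +P-cong ≋-refl (0∷-+P (p *P q) (p' *P q)) ⟨
    (scaleP a q +P scaleP b q) +P ((0# ∷ p *P q) +P (0# ∷ p' *P q))
      ≈⟨ +P-interchange (scaleP a q) (scaleP b q) _ _ ⟩
    (scaleP a q +P (0# ∷ p *P q)) +P (scaleP b q +P (0# ∷ p' *P q)) ∎
    where
    open ≋-Reasoning

  *P-distribˡ : ∀ p q q' → p *P (q +P q') ≋ p *P q +P p *P q'
  *P-distribˡ []      q q' = ≋-refl
  *P-distribˡ (a ∷ p) q q' = begin
    scaleP a (q +P q') +P (0# ∷ p *P (q +P q'))
      ≈⟨ +P-cong (scaleP-distribˡ a q q') (∷-cong refl (*P-distribˡ p q q')) ⟩
    (scaleP a q +P scaleP a q') +P (0# ∷ (p *P q +P p *P q'))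
      ≈⟨ +P-cong ≋-refl (0∷-+P (p *P q) (p *P q')) ⟨
    (scaleP a q +P scaleP a q') +P ((0# ∷ p *P q) +P (0# ∷ p *P q'))
      ≈⟨ +P-interchange (scaleP a q) (scaleP a q') _ _ ⟩
    (scaleP a q +P (0# ∷ p *P q)) +P (scaleP a q' +P (0# ∷ p *P q')) ∎
    where
    open ≋-Reasoning

  scaleP-*P : ∀ a q r → scaleP a q *P r ≋ scaleP a (q *P r)
  scaleP-*P a []      r = ≋-refl
  scaleP-*P a (b ∷ q) r = begin
    scaleP (a * b) r +P (0# ∷ scaleP a q *P r)
      ≈⟨ +P-cong (≋-sym (scaleP-assoc a b r)) (∷-cong (sym (zeroʳ a)) (scaleP-*P a q r)) ⟩
    scaleP a (scaleP b r) +P scaleP a (0# ∷ q *P r)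
      ≈⟨ scaleP-distribˡ a (scaleP b r) (0# ∷ q *P r) ⟨
    scaleP a (scaleP b r +P (0# ∷ q *P r)) ∎
    where
    open ≋-Reasoning

  *P-assoc : ∀ p q r → (p *P q) *P r ≋ p *P (q *P r)
  *P-assoc []      q r = ≋-refl
  *P-assoc (a ∷ p) q r = begin
    (scaleP a q +P (0# ∷ p *P q)) *P r       ≈⟨ *P-distribʳ (scaleP a q) _ r ⟩
    scaleP a q *P r +P (0# ∷ p *P q) *P r    ≈⟨ +P-cong (scaleP-*P a q r) (0∷-*P (p *P q) r) ⟩
    scaleP a (q *P r) +P (0# ∷ (p *P q) *P r) ≈⟨ +P-cong ≋-refl (∷-cong refl (*P-assoc p q r)) ⟩
    scaleP a (q *P r) +P (0# ∷ p *P (q *P r)) ∎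
    where
    open ≋-Reasoning

  *P-∷ : ∀ q a p → q *P (a ∷ p) ≋ scaleP a q +P (0# ∷ q *P p)
  *P-∷ []      a p = ≋-sym (∷≋0 refl ≋-refl)
  *P-∷ (b ∷ q) a p = ∷-cong (trans (+-identityʳ _) (trans (*-comm b a) (sym (+-identityʳ _)))) (begin
    scaleP b p +P q *P (a ∷ p)                        ≈⟨ +P-cong ≋-refl (*P-∷ q a p) ⟩
    scaleP b p +P (scaleP a q +P (0# ∷ q *P p))       ≈⟨ +P-assoc (scaleP b p) (scaleP a q) _ ⟨
    (scaleP b p +P scaleP a q) +P (0# ∷ q *P p)       ≈⟨ +P-cong (+P-comm (scaleP b p) (scaleP a q)) ≋-refl ⟩
    (scaleP a q +P scaleP b p) +P (0# ∷ q *P p)       ≈⟨ +P-assoc (scaleP a q) (scaleP b p) _ ⟩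
    scaleP a q +P (scaleP b p +P (0# ∷ q *P p))       ∎)
    where
    open ≋-Reasoning

  *P-comm : ∀ p q → p *P q ≋ q *P p
  *P-comm []      q = ≋-sym (*P-zeroʳ q)
  *P-comm (a ∷ p) q = ≋-trans (+P-cong ≋-refl (∷-cong refl (*P-comm p q))) (≋-sym (*P-∷ q a p))

  *P-identityˡ : ∀ p → oneP *P p ≋ p
  *P-identityˡ p = ≋-trans (+P-cong (scaleP-identity p) (∷≋0 refl ≋-refl)) (+P-identityʳ p)

  *P-identityʳ : ∀ p → p *P oneP ≋ p
  *P-identityʳ p = ≋-trans (*P-comm p oneP) (*P-identityˡ p)

  polynomialRing : CommutativeRing 0ℓ 0ℓ
  polynomialRing = record
    { Carrier = Pol ; _≈_ = _≋_ ; _+_ = _+P_ ; _*_ = _*P_ ; -_ = -P_ ; 0# = [] ; 1# = oneP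
    ; isCommutativeRing = record
      { isRing = record
        { +-isAbelianGroup = record
          { isGroup = record
            { isMonoid = record
              { isSemigroup = record
                { isMagma = record { isEquivalence = Setoid.isEquivalence ≋-setoid ; ∙-cong = +P-cong }
                ; assoc = +P-assoc }
              ; identity = (λ _ → ≋-refl) , +P-identityʳ }
            ; inverse = -P-inverseˡ , -P-inverseʳ
            ; ⁻¹-cong = -P-cong }
          ; comm = +P-comm }
        ; *-cong = *P-cong
        ; *-assoc = *P-assoc
        ; *-identity = *P-identityˡ , *P-identityʳ
        ; distrib = *P-distribˡ , λ q p p' → *P-distribʳ p p' q }
      ; *-comm = *P-comm } }

  0∷≋t*P : ∀ p → (0# ∷ p) ≋ tP *P p
  0∷≋t*P p = ≋-sym (≋-trans (+P-cong (scaleP-zero p refl) (∷-cong refl (*P-identityˡ p))) ≋-refl)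

  scaleP≋const*P : ∀ a q → scaleP a q ≋ constP a *P q
  scaleP≋const*P a q = ≋-sym (≋-trans (+P-cong ≋-refl (∷≋0 refl ≋-refl)) (+P-identityʳ _))

  ∷≋const+t*P : ∀ a p → (a ∷ p) ≋ constP a +P tP *P p
  ∷≋const+t*P a p = ≋-trans (∷-cong (sym (+-identityʳ a)) ≋-refl) (+P-cong {p = constP a} ≋-refl (0∷≋t*P p))

  constP-cong : ∀ {a b} → a ≈ b → constP a ≋ constP b
  constP-cong a≈b = ∷-cong a≈b ≋-refl

  constP-* : ∀ a b → constP (a * b) ≋ constP a *P constP b
  constP-* a b = ∷-cong (sym (+-identityʳ _)) ≋-refl

  private module R-Solver = IntegerCoefficientSolver R
  module P-Solver = IntegerCoefficientSolver polynomialRing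

  open import Algebra.Properties.Semiring.Exp semiring using () renaming (_^_ to _^ᴿ_)
  open import Algebra.Properties.Semiring.Mult semiring using (_×_; ×-congʳ; ×-comm-*)
  open import Algebra.Properties.CommutativeMonoid.Mult +-commutativeMonoid using (×-distrib-+)

  eval-≈[] : ∀ {p} x → p ≋ [] → eval p x ≈ 0#
  eval-≈[] {[]}    x p≈0 = refl
  eval-≈[] {c ∷ p} x p≈0 = trans
    (+-cong (∷≋0⇒head≈0 p≈0) (trans (*-congˡ (eval-≈[] x (∷≋0⇒tail≋0 p≈0))) (zeroʳ x)))
    (+-identityʳ 0#)

  eval-cong : ∀ {p q} x → p ≋ q → eval p x ≈ eval q x
  eval-cong {[]}    {q}     x p≈q = sym (eval-≈[] x (≋-sym p≈q))
  eval-cong {a ∷ p} {[]}    x p≈q = eval-≈[] x p≈q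
  eval-cong {a ∷ p} {b ∷ q} x p≈q =
    +-cong (∷-injectiveˡ p≈q) (*-congˡ (eval-cong x (∷-injectiveʳ p≈q)))

  eval-+P : ∀ p q x → eval (p +P q) x ≈ eval p x + eval q x
  eval-+P []      q       x = sym (+-identityˡ _)
  eval-+P (a ∷ p) []      x = sym (+-identityʳ _)
  eval-+P (a ∷ p) (b ∷ q) x = begin
    (a + b) + x * eval (p +P q) x             ≈⟨ +-congˡ (*-congˡ (eval-+P p q x)) ⟩
    (a + b) + x * (eval p x + eval q x)       ≈⟨ solve 5 (λ a b x u v →
                                                   (a :+ b) :+ x :* (u :+ v) := (a :+ x :* u) :+ (b :+ x :* v))
                                                   refl a b x (eval p x) (eval q x) ⟩
    (a + x * eval p x) + (b + x * eval q x)   ∎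
    where
    open ≈-Reasoning
    open R-Solver

  eval-scaleP : ∀ c p x → eval (scaleP c p) x ≈ c * eval p x
  eval-scaleP c []      x = sym (zeroʳ c)
  eval-scaleP c (a ∷ p) x = begin
    c * a + x * eval (scaleP c p) x  ≈⟨ +-congˡ (*-congˡ (eval-scaleP c p x)) ⟩
    c * a + x * (c * eval p x)       ≈⟨ solve 4 (λ c a x u → c :* a :+ x :* (c :* u) := c :* (a :+ x :* u))
                                          refl c a x (eval p x) ⟩
    c * (a + x * eval p x)           ∎
    where
    open ≈-Reasoning
    open R-Solver

  eval--P : ∀ p x → eval (-P p) x ≈ - eval p x
  eval--P []      x = sym -0#≈0#
  eval--P (a ∷ p) x = begin
    - a + x * eval (-P p) x   ≈⟨ +-congˡ (*-congˡ (eval--P p x)) ⟩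
    - a + x * (- eval p x)    ≈⟨ solve 3 (λ a x u → :- a :+ x :* (:- u) := :- (a :+ x :* u)) refl a x (eval p x) ⟩
    - (a + x * eval p x)      ∎
    where
    open ≈-Reasoning
    open R-Solver

  eval-*P : ∀ p q x → eval (p *P q) x ≈ eval p x * eval q x
  eval-*P []      q x = sym (zeroˡ _)
  eval-*P (a ∷ p) q x = begin
    eval (scaleP a q +P (0# ∷ p *P q)) x               ≈⟨ eval-+P (scaleP a q) _ x ⟩
    eval (scaleP a q) x + (0# + x * eval (p *P q) x)   ≈⟨ +-cong (eval-scaleP a q x)
                                                             (trans (+-identityˡ _) (*-congˡ (eval-*P p q x))) ⟩
    a * eval q x + x * (eval p x * eval q x)           ≈⟨ solve 4 (λ a x u v → a :* v :+ x :* (u :* v) := (a :+ x :* u) :* v)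
                                                             refl a x (eval p x) (eval q x) ⟩
    (a + x * eval p x) * eval q x                      ∎
    where
    open ≈-Reasoning
    open R-Solver

  eval-constP : ∀ c x → eval (constP c) x ≈ c
  eval-constP c x = trans (+-congˡ (zeroʳ x)) (+-identityʳ c)

  eval-tP : ∀ x → eval tP x ≈ x
  eval-tP x = trans (+-identityˡ _) (trans (*-congˡ (eval-constP 1# x)) (*-identityʳ x))

  eval-^P : ∀ p n x → eval (p ^P n) x ≈ eval p x ^ᴿ n
  eval-^P p zero    x = eval-constP 1# x
  eval-^P p (suc n) x = trans (eval-*P p (p ^P n) x) (*-congˡ (eval-^P p n x))

  natMul≡× : ∀ n c → natMul n c ≡ n × c
  natMul≡× zero    c = ≡.refl
  natMul≡× (suc n) c = ≡.cong (c +_) (natMul≡× n c)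

  ×-zeroʳ : ∀ n → n × 0# ≈ 0#
  ×-zeroʳ zero    = refl
  ×-zeroʳ (suc n) = trans (+-identityˡ _) (×-zeroʳ n)

  -‿distrib-× : ∀ n x → - (n × x) ≈ n × (- x)
  -‿distrib-× zero    x = -0#≈0#
  -‿distrib-× (suc n) x = trans (sym (-‿+-comm x (n × x))) (+-congˡ (-‿distrib-× n x))

  coeff-derivAux : ∀ k p n → coeff (derivAux k p) n ≈ (k ℕ.+ n) × coeff p n
  coeff-derivAux k []      n = sym (×-zeroʳ (k ℕ.+ n))
  coeff-derivAux k (c ∷ p) zero    =
    reflexive (≡.trans (natMul≡× k c) (≡.cong (_× c) (≡.sym (ℕₚ.+-identityʳ k))))
  coeff-derivAux k (c ∷ p) (suc n) =
    trans (coeff-derivAux (suc k) p n) (reflexive (≡.cong (_× coeff p n) (≡.sym (ℕₚ.+-suc k n))))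

  coeff-deriv : ∀ p n → coeff (deriv p) n ≈ suc n × coeff p (suc n)
  coeff-deriv []      n = sym (×-zeroʳ (suc n))
  coeff-deriv (c ∷ p) n = coeff-derivAux 1 p n

  deriv-cong : ∀ {p q} → p ≋ q → deriv p ≋ deriv q
  deriv-cong {p} {q} (coeffwise e) = coeffwise λ n →
    trans (coeff-deriv p n) (trans (×-congʳ (suc n) (e (suc n))) (sym (coeff-deriv q n)))

  deriv-+P : ∀ p q → deriv (p +P q) ≋ deriv p +P deriv q
  deriv-+P p q = coeffwise λ n → begin
    coeff (deriv (p +P q)) n                                ≈⟨ coeff-deriv (p +P q) n ⟩
    suc n × coeff (p +P q) (suc n)                          ≈⟨ ×-congʳ (suc n) (coeff-+P p q (suc n)) ⟩
    suc n × (coeff p (suc n) + coeff q (suc n))             ≈⟨ ×-distrib-+ _ _ (suc n) ⟩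
    suc n × coeff p (suc n) + suc n × coeff q (suc n)       ≈⟨ +-cong (coeff-deriv p n) (coeff-deriv q n) ⟨
    coeff (deriv p) n + coeff (deriv q) n                   ≈⟨ coeff-+P (deriv p) (deriv q) n ⟨
    coeff (deriv p +P deriv q) n                            ∎
    where
    open ≈-Reasoning

  deriv--P : ∀ p → deriv (-P p) ≋ -P deriv p
  deriv--P p = coeffwise λ n → begin
    coeff (deriv (-P p)) n           ≈⟨ coeff-deriv (-P p) n ⟩
    suc n × coeff (-P p) (suc n)     ≈⟨ ×-congʳ (suc n) (coeff--P p (suc n)) ⟩
    suc n × (- coeff p (suc n))      ≈⟨ -‿distrib-× (suc n) _ ⟨
    - (suc n × coeff p (suc n))      ≈⟨ -‿cong (coeff-deriv p n) ⟨
    - coeff (deriv p) n              ≈⟨ coeff--P (deriv p) n ⟨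
    coeff (-P deriv p) n             ∎
    where
    open ≈-Reasoning

  deriv-scaleP : ∀ c p → deriv (scaleP c p) ≋ scaleP c (deriv p)
  deriv-scaleP c p = coeffwise λ n → begin
    coeff (deriv (scaleP c p)) n        ≈⟨ coeff-deriv (scaleP c p) n ⟩
    suc n × coeff (scaleP c p) (suc n)  ≈⟨ ×-congʳ (suc n) (coeff-scaleP c p (suc n)) ⟩
    suc n × (c * coeff p (suc n))       ≈⟨ ×-comm-* (suc n) c _ ⟨
    c * (suc n × coeff p (suc n))       ≈⟨ *-congˡ (coeff-deriv p n) ⟨
    c * coeff (deriv p) n               ≈⟨ coeff-scaleP c (deriv p) n ⟨
    coeff (scaleP c (deriv p)) n        ∎
    where
    open ≈-Reasoning

  deriv-0∷ : ∀ p → deriv (0# ∷ p) ≋ p +P (0# ∷ deriv p)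
  deriv-0∷ p = coeffwise λ n →
    trans (coeff-derivAux 1 p n) (sym (trans (coeff-+P p (0# ∷ deriv p) n) (step n)))
    where
    step : ∀ n → coeff p n + coeff (0# ∷ deriv p) n ≈ suc n × coeff p n
    step zero    = refl
    step (suc n) = +-congˡ (coeff-deriv p n)

  deriv-tP : deriv tP ≋ oneP
  deriv-tP = ∷-cong (+-identityʳ 1#) ≋-refl

  deriv-*P : ∀ p q → deriv (p *P q) ≋ deriv p *P q +P p *P deriv q
  deriv-*P []      q = ≋-refl
  deriv-*P (a ∷ p) q = begin
    deriv (scaleP a q +P (0# ∷ p *P q))
      ≈⟨ deriv-+P (scaleP a q) _ ⟩
    deriv (scaleP a q) +P deriv (0# ∷ p *P q)
      ≈⟨ +P-cong (≋-trans (deriv-scaleP a q) (scaleP≋const*P a q')) (deriv-0∷ (p *P q)) ⟩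
    a′ *P q' +P (p *P q +P (0# ∷ deriv (p *P q)))
      ≈⟨ +P-cong {p = a′ *P q'} ≋-refl (+P-cong {p = p *P q} ≋-refl
           (≋-trans (0∷≋t*P _) (*P-congʳ tP (deriv-*P p q)))) ⟩
    a′ *P q' +P (p *P q +P tP *P (p' *P q +P p *P q'))
      ≈⟨ solve 6 (λ a′ p p' q q' t →
           a′ :* q' :+ (p :* q :+ t :* (p' :* q :+ p :* q')) := (p :+ t :* p') :* q :+ (a′ :+ t :* p) :* q')
           ≋-refl a′ p p' q q' tP ⟩
    (p +P tP *P p') *P q +P (a′ +P tP *P p) *P q'
      ≈⟨ +P-cong (*P-congˡ q (≋-trans (+P-cong {p = p} ≋-refl (≋-sym (0∷≋t*P p'))) (≋-sym (deriv-0∷ p))))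
                 (*P-congˡ q' (≋-sym (∷≋const+t*P a p))) ⟩
    deriv (a ∷ p) *P q +P (a ∷ p) *P deriv q ∎
    where
    open ≋-Reasoning
    open P-Solver using (solve; _:+_; _:*_; _:=_)
    a′ = constP a
    p' = deriv p
    q' = deriv q

  deriv-^P : ∀ f k → deriv (f ^P suc k) ≋ constP (suc k × 1#) *P (deriv f *P f ^P k)
  deriv-^P f zero = begin
    deriv (f *P oneP)                       ≈⟨ deriv-*P f oneP ⟩
    f' *P oneP +P f *P []                   ≈⟨ +P-cong {p = f' *P oneP} ≋-refl (*P-zeroʳ f) ⟩
    f' *P oneP +P []                        ≈⟨ +P-identityʳ _ ⟩
    f' *P oneP                              ≈⟨ *P-identityˡ _ ⟨
    oneP *P (f' *P oneP)                    ≈⟨ *P-congˡ (f' *P oneP) (constP-cong (sym (+-identityʳ 1#))) ⟩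
    constP (1 × 1#) *P (f' *P oneP)         ∎
    where
    open ≋-Reasoning
    f' = deriv f
  deriv-^P f (suc k) = begin
    deriv (f *P (f *P fᵏ))
      ≈⟨ deriv-*P f (f *P fᵏ) ⟩
    f' *P (f *P fᵏ) +P f *P deriv (f *P fᵏ)
      ≈⟨ +P-cong {p = f' *P (f *P fᵏ)} ≋-refl (*P-congʳ f (deriv-^P f k)) ⟩
    f' *P (f *P fᵏ) +P f *P (n *P (f' *P fᵏ))
      ≈⟨ solve 4 (λ f f' fᵏ n → f' :* (f :* fᵏ) :+ f :* (n :* (f' :* fᵏ)) := (con (+ 1) :+ n) :* (f' :* (f :* fᵏ)))
                 ≋-refl f f' fᵏ n ⟩
    (oneP +P n) *P (f' *P (f *P fᵏ))
      ∎
    where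
    open ≋-Reasoning
    open P-Solver using (solve; _:+_; _:*_; _:=_; con)
    open import Data.Integer using (+_)
    f' = deriv f
    fᵏ = f ^P k
    n = constP (suc k × 1#)

  deriv-^P≋0 : ∀ f n → n × 1# ≈ 0# → deriv (f ^P n) ≋ []
  deriv-^P≋0 f zero    _      = ≋-refl
  deriv-^P≋0 f (suc k) n×1≈0 = ≋-trans (deriv-^P f k) (*P-zeroˡ _ (∷≋0 n×1≈0 ≋-refl))

  open import Algebra.Properties.Semiring.Divisibility (CommutativeRing.semiring polynomialRing) public
    using (_∣_; _∣ʳ_; module _∣ʳ_; _,_; _∣0; ∣ʳ-refl; ∣ʳ-trans; x∣ʳy⇒x∣ʳzy; ∣ʳ-respʳ-≈)
  open import Algebra.Properties.CommutativeSemigroup.Divisibility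
    (CommutativeRing.*-commutativeSemigroup polynomialRing) public using (x∣xy; xy≈z⇒x∣z)
  open import Algebra.Properties.Ring (CommutativeRing.ring polynomialRing)
    using () renaming (-‿distribˡ-* to -P‿distribˡ-*P)

  ∣P⇒∣ : ∀ {f g} → f ∣P g → f ∣ g
  ∣P⇒∣ {f} (h , fh≈g) = xy≈z⇒x∣z f h (coeffwise fh≈g)

  ∣⇒∣P : ∀ {f g} → f ∣ g → f ∣P g
  ∣⇒∣P {f} (h , hf≈g) = h , coeff-≈ (≋-trans (*P-comm f h) hf≈g)

  ∣-+P : ∀ {f g h} → f ∣ g → f ∣ h → f ∣ g +P h
  ∣-+P {f} (u , uf≈g) (v , vf≈h) = u +P v , ≋-trans (*P-distribʳ u v f) (+P-cong uf≈g vf≈h)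

  ∣--P : ∀ {f g} → f ∣ g → f ∣ -P g
  ∣--P {f} (u , uf≈g) = -P u , ≋-trans (≋-sym (-P‿distribˡ-*P u f)) (-P-cong uf≈g)

  syntheticQuotient : Carrier → Pol → Pol
  syntheticQuotient x []      = []
  syntheticQuotient x (c ∷ p) = eval p x ∷ syntheticQuotient x p

  synthetic-division : ∀ x p → (tP -P constP x) *P syntheticQuotient x p ≋ p -P constP (eval p x)
  synthetic-division x []      = ≋-trans (*P-zeroʳ (tP -P constP x)) (≋-sym (∷≋0 -0#≈0# ≋-refl))
  synthetic-division x (c ∷ p) = begin
    (tP -P x′) *P (v ∷ s)                              ≈⟨ *P-∷ (tP -P x′) v s ⟩
    scaleP v (tP -P x′) +P (0# ∷ (tP -P x′) *P s)      ≈⟨ +P-cong (scaleP≋const*P v (tP -P x′))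
                                                            (≋-trans (0∷≋t*P _) (*P-congʳ tP (synthetic-division x p))) ⟩
    v′ *P (tP -P x′) +P tP *P (p -P v′)                ≈⟨ solve 5 (λ v′ t x′ p c′ →
                                                            v′ :* (t :- x′) :+ t :* (p :- v′) := (c′ :+ t :* p) :- (c′ :+ x′ :* v′))
                                                            ≋-refl v′ tP x′ p (constP c) ⟩
    (constP c +P tP *P p) -P (constP c +P x′ *P v′)    ≈⟨ +P-cong (≋-sym (∷≋const+t*P c p))
                                                            (-P-cong (+P-cong {p = constP c} ≋-refl (≋-sym (constP-* x v)))) ⟩
    (c ∷ p) -P constP (c + x * v)                      ∎
    where
    open ≋-Reasoning
    open P-Solver using (solve; _:+_; _:*_; _:-_; _:=_)
    v = eval p x
    s = syntheticQuotient x p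
    x′ = constP x
    v′ = constP v

  -- Differentiate (t - x) q = p - c and evaluate at t = x.
  eval-quotient-by-linear : ∀ {x c p q} → (tP -P constP x) *P q ≋ p -P constP c → eval q x ≈ eval (deriv p) x
  eval-quotient-by-linear {x} {c} {p} {q} eq = begin
    eval q x                                               ≈⟨ lemma ⟨
    eval (deriv t-x *P q +P t-x *P deriv q) x              ≈⟨ eval-cong x (≋-sym (deriv-*P t-x q)) ⟩
    eval (deriv (t-x *P q)) x                              ≈⟨ eval-cong x (deriv-cong eq) ⟩
    eval (deriv (p -P constP c)) x                         ≈⟨ eval-cong x (≋-trans (deriv-+P p (-P constP c)) (+P-identityʳ (deriv p))) ⟩
    eval (deriv p) x                                       ∎
    where
    open ≈-Reasoning
    t-x = tP -P constP x
    t-x-at-x : eval t-x x ≈ 0#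
    t-x-at-x = trans (eval-+P tP (-P constP x) x)
                 (trans (+-cong (eval-tP x) (trans (eval--P (constP x) x) (-‿cong (eval-constP x x)))) (-‿inverseʳ x))
    deriv-t-x : deriv t-x ≋ oneP
    deriv-t-x = ≋-trans (deriv-+P tP (-P constP x)) (≋-trans (+P-identityʳ (deriv tP)) deriv-tP)
    lemma : eval (deriv t-x *P q +P t-x *P deriv q) x ≈ eval q x
    lemma = begin
      eval (deriv t-x *P q +P t-x *P deriv q) x              ≈⟨ eval-+P (deriv t-x *P q) _ x ⟩
      eval (deriv t-x *P q) x + eval (t-x *P deriv q) x      ≈⟨ +-cong (eval-*P (deriv t-x) q x) (eval-*P t-x (deriv q) x) ⟩
      eval (deriv t-x) x * eval q x + eval t-x x * eval (deriv q) x
        ≈⟨ +-cong (*-congʳ (trans (eval-cong x deriv-t-x) (eval-constP 1# x)))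
                  (trans (*-congʳ t-x-at-x) (zeroˡ _)) ⟩
      1# * eval q x + 0#                                     ≈⟨ trans (+-identityʳ _) (*-identityˡ _) ⟩
      eval q x                                               ∎

module PolynomialMap
  (R S : CommutativeRing 0ℓ 0ℓ)
  (f : CommutativeRing.Carrier R → CommutativeRing.Carrier S)
  (isHom : RingMorphisms.IsRingHomomorphism (CommutativeRing.rawRing R) (CommutativeRing.rawRing S) f)
  where

  private
    module R = CommutativeRing R
    module S = CommutativeRing S
    module R[t] = Polynomials R
    module S[t] = Polynomials S
  open Poly R using (Pol; _+P_; -P_; _*P_; _^P_; scaleP; deriv; oneP; coeff)
  open Poly S using () renaming (_+P_ to _+Q_; -P_ to -Q_; _*P_ to _*Q_; _^P_ to _^Q_; scaleP to scaleQ;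
                                   deriv to derivQ; oneP to oneQ; coeff to coeffQ)
  open RingMorphisms.IsRingHomomorphism isHom
  open S using (_≈_; refl; sym; trans)
  open S[t] using (_≋_; coeffwise; ≋-refl; ≋-trans)

  coeff-map : ∀ p n → coeffQ (map f p) n ≈ f (coeff p n)
  coeff-map []      n       = sym 0#-homo
  coeff-map (a ∷ p) zero    = refl
  coeff-map (a ∷ p) (suc n) = coeff-map p n

  private
    coeffwise-map : ∀ p {q} → (∀ n → f (coeff p n) ≈ coeffQ q n) → map f p ≋ q
    coeffwise-map p e = coeffwise λ n → trans (coeff-map p n) (e n)

  map-cong : ∀ {p q} → p R[t].≋ q → map f p ≋ map f q
  map-cong {p} {q} (R[t].coeffwise e) = coeffwise-map p λ n → trans (⟦⟧-cong (e n)) (sym (coeff-map q n))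

  map-+P : ∀ p q → map f (p +P q) ≋ map f p +Q map f q
  map-+P p q = coeffwise-map (p +P q) λ n → trans (⟦⟧-cong (R[t].coeff-+P p q n)) (trans (+-homo _ _)
    (sym (trans (S[t].coeff-+P (map f p) (map f q) n) (S.+-cong (coeff-map p n) (coeff-map q n)))))

  map--P : ∀ p → map f (-P p) ≋ -Q map f p
  map--P p = coeffwise-map (-P p) λ n → trans (⟦⟧-cong (R[t].coeff--P p n)) (trans (-‿homo _)
    (sym (trans (S[t].coeff--P (map f p) n) (S.-‿cong (coeff-map p n)))))

  map-scaleP : ∀ c p → map f (scaleP c p) ≋ scaleQ (f c) (map f p)
  map-scaleP c p = coeffwise-map (scaleP c p) λ n → trans (⟦⟧-cong (R[t].coeff-scaleP c p n)) (trans (*-homo _ _)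
    (sym (trans (S[t].coeff-scaleP (f c) (map f p) n) (S.*-congˡ (coeff-map p n)))))

  map-*P : ∀ p q → map f (p *P q) ≋ map f p *Q map f q
  map-*P []      q = ≋-refl
  map-*P (a ∷ p) q = ≋-trans (map-+P (scaleP a q) (R.0# ∷ p *P q))
    (S[t].+P-cong (map-scaleP a q) (S[t].∷-cong 0#-homo (map-*P p q)))

  map-oneP : map f oneP ≋ oneQ
  map-oneP = S[t].∷-cong 1#-homo ≋-refl

  map-^P : ∀ p n → map f (p ^P n) ≋ map f p ^Q n
  map-^P p zero    = map-oneP
  map-^P p (suc n) = ≋-trans (map-*P p (p ^P n)) (S[t].*P-congʳ (map f p) (map-^P p n))

  private
    module R× = Algebra.Properties.Semiring.Mult R.semiring
    module S× = Algebra.Properties.Semiring.Mult S.semiring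

    ×-homo : ∀ n x → f (n R×.× x) ≈ n S×.× f x
    ×-homo zero    x = 0#-homo
    ×-homo (suc n) x = trans (+-homo _ _) (S.+-congˡ (×-homo n x))

  map-deriv : ∀ p → map f (deriv p) ≋ derivQ (map f p)
  map-deriv p = coeffwise-map (deriv p) λ n → trans (⟦⟧-cong (R[t].coeff-deriv p n)) (trans (×-homo (suc n) _)
    (sym (trans (S[t].coeff-deriv (map f p) n) (S×.×-congʳ (suc n) (coeff-map p (suc n))))))

module _ {c ℓ} (M : CommutativeMonoid c ℓ) where
  open CommutativeMonoid M
  open Algebra.Properties.CommutativeMonoid.Sum M

  sum-supported-at : ∀ {m} (t : Fin m → Carrier) i → (∀ j → j ≢ i → t j ≈ ε) → sum t ≈ t i
  sum-supported-at {suc m} t i t≈ε = begin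
    sum t                       ≈⟨ sum-remove t ⟩
    t i ∙ sum (removeAt t i)    ≈⟨ ∙-congˡ (sum-cong-≋ λ j → t≈ε (punchIn i j) (punchInᵢ≢i i j)) ⟩
    t i ∙ sum (replicate m ε)   ≈⟨ ∙-congˡ (sum-replicate-zero m) ⟩
    t i ∙ ε                     ≈⟨ identityʳ (t i) ⟩
    t i                         ∎
    where
    open Relation.Binary.Reasoning.Setoid setoid

module FiniteFieldFacts {n : ℕ} (F : FiniteField n) where
  open FiniteField F renaming (ring to R)
  open CommutativeRing R hiding (zero)
  open import Algebra.Properties.Ring ring using (+-cancelʳ)
  open import Algebra.Properties.Semiring.Mult semiring using (_×_)
  open import Algebra.Properties.Semiring.Exp semiring using () renaming (_^_ to _^ᴿ_)
  open Relation.Binary.Reasoning.Setoid setoid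
  private
    module Σ+ = Algebra.Properties.CommutativeMonoid.Sum +-commutativeMonoid
    module Π* = Algebra.Properties.CommutativeMonoid.Sum *-commutativeMonoid

  index : Carrier → Fin n
  index x = proj₁ (enum-sur x)

  enum-index : ∀ x → enum (index x) ≈ x
  enum-index x = proj₂ (enum-sur x)

  infix 4 _≟_
  _≟_ : ∀ x y → Dec (x ≈ y)
  x ≟ y with index x Fin.≟ index y
  ... | yes i≡j = yes (trans (sym (enum-index x)) (trans (reflexive (≡.cong enum i≡j)) (enum-index y)))
  ... | no  i≢j = no λ x≈y → i≢j (enum-inj _ _ (trans (enum-index x) (trans x≈y (sym (enum-index y)))))

  -- The carrier is finite, so a bijection of it induces a permutation of the indices.
  sum-∘-bijection :
    (M : CommutativeMonoid 0ℓ 0ℓ) (φ : Carrier → CommutativeMonoid.Carrier M) →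
    (∀ {x y} → x ≈ y → CommutativeMonoid._≈_ M (φ x) (φ y)) →
    (g h : Carrier → Carrier) → (∀ {x y} → x ≈ y → g x ≈ g y) → (∀ {x y} → x ≈ y → h x ≈ h y) →
    (∀ x → g (h x) ≈ x) → (∀ x → h (g x) ≈ x) →
    let open Algebra.Properties.CommutativeMonoid.Sum M in
    CommutativeMonoid._≈_ M (sum (λ i → φ (enum i))) (sum (λ i → φ (g (enum i))))
  sum-∘-bijection M φ φ-cong g h g-cong h-cong gh≈id hg≈id =
    M.trans (sum-permute (λ i → φ (enum i)) π)
            (sum-cong-≋ {x = λ i → φ (enum (along g i))} λ i → φ-cong (enum-index _))
    where
    module M = CommutativeMonoid M
    open Algebra.Properties.CommutativeMonoid.Sum M
    along : (Carrier → Carrier) → Fin n → Fin n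
    along k i = index (k (enum i))
    along-inverse : ∀ k l → (∀ {x y} → x ≈ y → k x ≈ k y) → (∀ x → k (l x) ≈ x) →
                    ∀ i → along k (along l i) ≡ i
    along-inverse k l k-cong kl≈id i =
      enum-inj _ _ (trans (enum-index _) (trans (k-cong (enum-index _)) (kl≈id _)))
    π : Permutation n n
    π = permutation (along g) (along h) (along-inverse g h g-cong gh≈id) (along-inverse h g h-cong hg≈id)

  n×x≈0 : ∀ x → n × x ≈ 0#
  n×x≈0 x = +-cancelʳ S (n × x) 0# (begin
    n × x + S                              ≈⟨ +-congʳ (Σ+.sum-replicate n) ⟨
    Σ+.sum (replicate n x) + S             ≈⟨ Σ+.∑-distrib-+ (replicate n x) enum ⟨
    Σ+.sum (λ i → x + enum i)              ≈⟨ sum-∘-bijection +-commutativeMonoid (λ z → z) (λ e → e)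
                                                (x +_) (- x +_) +-congˡ +-congˡ x+[-x+z]≈z -x+[x+z]≈z ⟨
    S                                      ≈⟨ +-identityˡ S ⟨
    0# + S                                 ∎)
    where
    S = Σ+.sum enum
    x+[-x+z]≈z : ∀ z → x + (- x + z) ≈ z
    x+[-x+z]≈z z = trans (sym (+-assoc _ _ _)) (trans (+-congʳ (-‿inverseʳ x)) (+-identityˡ z))
    -x+[x+z]≈z : ∀ z → - x + (x + z) ≈ z
    -x+[x+z]≈z z = trans (sym (+-assoc _ _ _)) (trans (+-congʳ (-‿inverseˡ x)) (+-identityˡ z))

  private
    ≉0-* : ∀ {a b} → ¬ a ≈ 0# → ¬ b ≈ 0# → ¬ a * b ≈ 0#
    ≉0-* {a} {b} a≉0 b≉0 ab≈0 = b≉0 (begin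
      b              ≈⟨ *-identityˡ b ⟨
      1# * b         ≈⟨ *-congʳ (trans (*-comm a⁻¹ a) aa⁻¹≈1) ⟨
      (a⁻¹ * a) * b  ≈⟨ *-assoc _ _ _ ⟩
      a⁻¹ * (a * b)  ≈⟨ *-congˡ ab≈0 ⟩
      a⁻¹ * 0#       ≈⟨ zeroʳ _ ⟩
      0#             ∎)
      where
      a⁻¹ = proj₁ (inverse a a≉0)
      aa⁻¹≈1 = proj₂ (inverse a a≉0)

    *-cancelʳ-≉0 : ∀ {a b c} → ¬ c ≈ 0# → a * c ≈ b * c → a ≈ b
    *-cancelʳ-≉0 {a} {b} {c} c≉0 ac≈bc = begin
      a               ≈⟨ *-identityʳ a ⟨
      a * 1#          ≈⟨ *-congˡ cc⁻¹≈1 ⟨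
      a * (c * c⁻¹)   ≈⟨ *-assoc _ _ _ ⟨
      (a * c) * c⁻¹   ≈⟨ *-congʳ ac≈bc ⟩
      (b * c) * c⁻¹   ≈⟨ *-assoc _ _ _ ⟩
      b * (c * c⁻¹)   ≈⟨ *-congˡ cc⁻¹≈1 ⟩
      b * 1#          ≈⟨ *-identityʳ b ⟩
      b               ∎
      where
      c⁻¹ = proj₁ (inverse c c≉0)
      cc⁻¹≈1 = proj₂ (inverse c c≉0)

    product-≉0 : ∀ {m} (t : Fin m → Carrier) → (∀ i → ¬ t i ≈ 0#) → ¬ Π*.sum t ≈ 0#
    product-≉0 {zero}  t t≉0 = λ 1≈0 → 0≉1 (sym 1≈0)
    product-≉0 {suc m} t t≉0 =
      ≉0-* (t≉0 Fin.zero) (product-≉0 (λ i → t (Fin.suc i)) (λ i → t≉0 (Fin.suc i)))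

    -- z, except that 0 is replaced by 1, so that the product over the field is nonzero.
    unzero : Carrier → Carrier
    unzero z with z ≟ 0#
    ... | yes _ = 1#
    ... | no  _ = z

    unzero-cong : ∀ {x y} → x ≈ y → unzero x ≈ unzero y
    unzero-cong {x} {y} x≈y with x ≟ 0# | y ≟ 0#
    ... | yes _   | yes _   = refl
    ... | yes x≈0 | no  y≉0 = ⊥-elim (y≉0 (trans (sym x≈y) x≈0))
    ... | no  x≉0 | yes y≈0 = ⊥-elim (x≉0 (trans x≈y y≈0))
    ... | no  _   | no  _   = x≈y

    unzero-≉0 : ∀ z → ¬ unzero z ≈ 0#
    unzero-≉0 z with z ≟ 0#
    ... | yes _   = λ 1≈0 → 0≉1 (sym 1≈0)
    ... | no  z≉0 = z≉0

    -- The element of Fin m only witnesses m ≢ 0.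
    ≈0⇒^≈id : ∀ {m} → Fin m → ∀ {x} → x ≈ 0# → x ^ᴿ m ≈ x
    ≈0⇒^≈id {suc m} _ {x} x≈0 = trans (*-congʳ x≈0) (trans (zeroˡ _) (sym x≈0))

  module _ (y : Carrier) (y≉0 : ¬ y ≈ 0#) where
    private
      correction : Carrier → Carrier
      correction z with z ≟ 0#
      ... | yes _ = y
      ... | no  _ = 1#

      y*unzero : ∀ z → y * unzero z ≈ unzero (y * z) * correction z
      y*unzero z with z ≟ 0# | y * z ≟ 0#
      ... | yes _   | yes _    = trans (*-identityʳ y) (sym (*-identityˡ y))
      ... | yes z≈0 | no yz≉0  = ⊥-elim (yz≉0 (trans (*-congˡ z≈0) (zeroʳ y)))
      ... | no  z≉0 | yes yz≈0 = ⊥-elim (≉0-* y≉0 z≉0 yz≈0)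
      ... | no  _   | no  _    = sym (*-identityʳ _)

      product-correction : Π*.sum (λ i → correction (enum i)) ≈ y
      product-correction = trans (sum-supported-at *-commutativeMonoid _ (index 0#) away-from-0) at-0
        where
        away-from-0 : ∀ j → j ≢ index 0# → correction (enum j) ≈ 1#
        away-from-0 j j≢0 with enum j ≟ 0#
        ... | yes ej≈0 = ⊥-elim (j≢0 (enum-inj _ _ (trans ej≈0 (sym (enum-index 0#)))))
        ... | no  _    = refl
        at-0 : correction (enum (index 0#)) ≈ y
        at-0 with enum (index 0#) ≟ 0#
        ... | yes _    = refl
        ... | no  e≉0  = ⊥-elim (e≉0 (enum-index 0#))

      P = Π*.sum (λ i → unzero (enum i))

    -- Multiplication by y permutes the field; taking the product of unzero over it,
    -- the only factor not matched by the permutation is y, at the point 0.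
    ^n≈id-≉0 : y ^ᴿ n ≈ y
    ^n≈id-≉0 = *-cancelʳ-≉0 (product-≉0 _ (λ i → unzero-≉0 (enum i))) (begin
      y ^ᴿ n * P
        ≈⟨ *-congʳ (Π*.sum-replicate n) ⟨
      Π*.sum (replicate n y) * P
        ≈⟨ Π*.∑-distrib-+ (replicate n y) _ ⟨
      Π*.sum (λ i → y * unzero (enum i))
        ≈⟨ Π*.sum-cong-≋ (λ i → y*unzero (enum i)) ⟩
      Π*.sum (λ i → unzero (y * enum i) * correction (enum i))
        ≈⟨ Π*.∑-distrib-+ (λ i → unzero (y * enum i)) (λ i → correction (enum i)) ⟩
      Π*.sum (λ i → unzero (y * enum i)) * Π*.sum (λ i → correction (enum i))
        ≈⟨ *-cong (sum-∘-bijection *-commutativeMonoid unzero unzero-cong (y *_) (y⁻¹ *_) *-congˡ *-congˡ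
                                   y[y⁻¹z]≈z y⁻¹[yz]≈z)
                  (sym product-correction) ⟨
      P * y
        ≈⟨ *-comm P y ⟩
      y * P
        ∎)
      where
      y⁻¹ = proj₁ (inverse y y≉0)
      yy⁻¹≈1 = proj₂ (inverse y y≉0)
      y[y⁻¹z]≈z : ∀ z → y * (y⁻¹ * z) ≈ z
      y[y⁻¹z]≈z z = trans (sym (*-assoc _ _ _)) (trans (*-congʳ yy⁻¹≈1) (*-identityˡ z))
      y⁻¹[yz]≈z : ∀ z → y⁻¹ * (y * z) ≈ z
      y⁻¹[yz]≈z z = trans (sym (*-assoc _ _ _)) (trans (*-congʳ (trans (*-comm _ _) yy⁻¹≈1)) (*-identityˡ z))

  ^n≈id : ∀ x → x ^ᴿ n ≈ x
  ^n≈id x with x ≟ 0#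
  ... | yes x≈0 = ≈0⇒^≈id (index 0#) x≈0
  ... | no  x≉0 = ^n≈id-≉0 x x≉0

module EuclideanAlgorithm
  (R : CommutativeRing 0ℓ 0ℓ)
  (_≟_ : ∀ x y → Dec (CommutativeRing._≈_ R x y))
  (inverse : ∀ x → ¬ CommutativeRing._≈_ R x (CommutativeRing.0# R) →
             Σ (CommutativeRing.Carrier R) λ y → CommutativeRing._≈_ R (CommutativeRing._*_ R x y) (CommutativeRing.1# R))
  where

  open CommutativeRing R hiding (zero)
  open Poly R
  open Polynomials R
  open import Data.Nat using (_≤_; _≤?_; z≤n; s≤s; _∸_)
  open import Data.Product using (_×_)
  open import Data.List using (length)

  VanishesFrom : ℕ → Pol → Set
  VanishesFrom m p = ∀ i → m ≤ i → coeff p i ≈ 0#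

  vanishesFrom-length : ∀ p → VanishesFrom (length p) p
  vanishesFrom-length []      i       _         = refl
  vanishesFrom-length (c ∷ p) (suc i) (s≤s l≤i) = vanishesFrom-length p i l≤i

  vanishesFrom-pred : ∀ {m p} → VanishesFrom (suc m) p → coeff p m ≈ 0# → VanishesFrom m p
  vanishesFrom-pred {m} p↓ pₘ≈0 i m≤i with ℕₚ.m≤n⇒m<n∨m≡n m≤i
  ... | inj₁ m<i    = p↓ i m<i
  ... | inj₂ ≡.refl = pₘ≈0

  vanishesFrom-zero : ∀ {p} → VanishesFrom 0 p → p ≋ []
  vanishesFrom-zero p↓ = coeffwise λ i → p↓ i z≤n

  shift : ℕ → Pol → Pol
  shift zero    h = h
  shift (suc j) h = 0# ∷ shift j h

  coeff-shift : ∀ j h i → coeff (shift j h) (j ℕ.+ i) ≡ coeff h i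
  coeff-shift zero    h i = ≡.refl
  coeff-shift (suc j) h i = coeff-shift j h i

  vanishesFrom-shift : ∀ j {k h} → VanishesFrom k h → VanishesFrom (j ℕ.+ k) (shift j h)
  vanishesFrom-shift zero    h↓ = h↓
  vanishesFrom-shift (suc j) h↓ (suc i) (s≤s j+k≤i) = vanishesFrom-shift j h↓ i j+k≤i

  shift≋t^*P : ∀ j h → shift j h ≋ tP ^P j *P h
  shift≋t^*P zero    h = ≋-sym (*P-identityˡ h)
  shift≋t^*P (suc j) h = begin
    0# ∷ shift j h          ≈⟨ 0∷≋t*P (shift j h) ⟩
    tP *P shift j h         ≈⟨ *P-congʳ tP (shift≋t^*P j h) ⟩
    tP *P (tP ^P j *P h)    ≈⟨ *P-assoc tP (tP ^P j) h ⟨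
    tP ^P suc j *P h        ∎
    where
    open ≋-Reasoning

  -- Subtracting (gₘ / hₖ) tᵐ⁻ᵏ h from g kills the coefficient of tᵐ.
  cancel-leading : ∀ {m k g h} → VanishesFrom (suc m) g → VanishesFrom (suc k) h → k ≤ m →
                   ¬ coeff h k ≈ 0# → Σ Pol λ q → VanishesFrom m (g +P q *P h)
  cancel-leading {m} {k} {g} {h} g↓ h↓ k≤m hₖ≉0 =
    constP (- s) *P tP ^P j , vanishesFrom-pred {p = g₁} g₁↓ g₁ₘ≈0
    where
    j = m ∸ k
    j+k≡m : j ℕ.+ k ≡ m
    j+k≡m = ≡.trans (ℕₚ.+-comm j k) (ℕₚ.m+[n∸m]≡n k≤m)
    hₖ⁻¹ = proj₁ (inverse (coeff h k) hₖ≉0)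
    s = coeff g m * hₖ⁻¹
    g₁ = g +P (constP (- s) *P tP ^P j) *P h
    qh≋scaled-shift : (constP (- s) *P tP ^P j) *P h ≋ scaleP (- s) (shift j h)
    qh≋scaled-shift = begin
      (constP (- s) *P tP ^P j) *P h   ≈⟨ *P-assoc (constP (- s)) (tP ^P j) h ⟩
      constP (- s) *P (tP ^P j *P h)   ≈⟨ *P-congʳ (constP (- s)) (shift≋t^*P j h) ⟨
      constP (- s) *P shift j h        ≈⟨ scaleP≋const*P (- s) (shift j h) ⟨
      scaleP (- s) (shift j h)         ∎
      where
      open ≋-Reasoning
    coeff-g₁ : ∀ i → coeff g₁ i ≈ coeff g i + - s * coeff (shift j h) i
    coeff-g₁ i = begin
      coeff g₁ i                                           ≈⟨ coeff-+P g _ i ⟩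
      coeff g i + coeff ((constP (- s) *P tP ^P j) *P h) i ≈⟨ +-congˡ (coeff-≈ qh≋scaled-shift i) ⟩
      coeff g i + coeff (scaleP (- s) (shift j h)) i       ≈⟨ +-congˡ (coeff-scaleP (- s) (shift j h) i) ⟩
      coeff g i + - s * coeff (shift j h) i                ∎
      where
      open ≈-Reasoning
    shifted↓ : VanishesFrom (suc m) (shift j h)
    shifted↓ = ≡.subst (λ l → VanishesFrom l (shift j h)) (≡.trans (ℕₚ.+-suc j k) (≡.cong suc j+k≡m))
                       (vanishesFrom-shift j h↓)
    g₁↓ : VanishesFrom (suc m) g₁
    g₁↓ i m<i = trans (coeff-g₁ i)
      (trans (+-cong (g↓ i m<i) (trans (*-congˡ (shifted↓ i m<i)) (zeroʳ _))) (+-identityʳ 0#))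
    g₁ₘ≈0 : coeff g₁ m ≈ 0#
    g₁ₘ≈0 = begin
      coeff g₁ m
        ≈⟨ coeff-g₁ m ⟩
      coeff g m + - s * coeff (shift j h) m
        ≈⟨ +-congˡ (*-congˡ (reflexive (≡.trans (≡.cong (coeff (shift j h)) (≡.sym j+k≡m)) (coeff-shift j h k)))) ⟩
      coeff g m + - (coeff g m * hₖ⁻¹) * coeff h k
        ≈⟨ solve 3 (λ g c c⁻¹ → g :+ :- (g :* c⁻¹) :* c := g :- g :* (c :* c⁻¹)) refl (coeff g m) (coeff h k) hₖ⁻¹ ⟩
      coeff g m - coeff g m * (coeff h k * hₖ⁻¹)
        ≈⟨ +-congˡ (-‿cong (trans (*-congˡ (proj₂ (inverse _ hₖ≉0))) (*-identityʳ _))) ⟩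
      coeff g m - coeff g m
        ≈⟨ -‿inverseʳ _ ⟩
      0#
        ∎
      where
      open ≈-Reasoning
      open IntegerCoefficientSolver R using (solve; _:+_; _:*_; :-_; _:-_; _:=_)

  ∣-cancel : ∀ {d g h} q → d ∣ g +P q *P h → d ∣ h → d ∣ g
  ∣-cancel {d} {g} {h} q d∣g+qh d∣h = ∣ʳ-respʳ-≈ g+qh-qh≋g (∣-+P d∣g+qh (∣--P (x∣ʳy⇒x∣ʳzy q d∣h)))
    where
    open P-Solver using (solve; _:+_; _:*_; :-_; _:=_)
    g+qh-qh≋g : (g +P q *P h) +P (-P (q *P h)) ≋ g
    g+qh-qh≋g = solve 3 (λ g q h → (g :+ q :* h) :+ (:- (q :* h)) := g) ≋-refl g q h

  module _ (I : Pol → Set) (I-+* : ∀ g h q → I g → I h → I (g +P q *P h)) where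

    CommonDivisorIn : Pol → Pol → Set
    CommonDivisorIn g h = Σ Pol λ d → I d × d ∣ g × d ∣ h

    private
      common-divisor-bounded : ∀ m k g h → VanishesFrom m g → VanishesFrom k h → I g → I h → CommonDivisorIn g h
      common-divisor-bounded zero    k       g h g↓ h↓ Ig Ih =
        h , Ih , ∣ʳ-respʳ-≈ (≋-sym (vanishesFrom-zero g↓)) (h ∣0) , ∣ʳ-refl
      common-divisor-bounded (suc m) zero    g h g↓ h↓ Ig Ih =
        g , Ig , ∣ʳ-refl , ∣ʳ-respʳ-≈ (≋-sym (vanishesFrom-zero h↓)) (g ∣0)
      common-divisor-bounded (suc m) (suc k) g h g↓ h↓ Ig Ih with coeff g m ≟ 0# | coeff h k ≟ 0#
      ... | yes gₘ≈0 | _        = common-divisor-bounded m (suc k) g h (vanishesFrom-pred {p = g} g↓ gₘ≈0) h↓ Ig Ih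
      ... | no  _    | yes hₖ≈0 = common-divisor-bounded (suc m) k g h g↓ (vanishesFrom-pred {p = h} h↓ hₖ≈0) Ig Ih
      ... | no  gₘ≉0 | no  hₖ≉0 with k ≤? m
      ...   | yes k≤m =
        let q , g₁↓ = cancel-leading {g = g} {h = h} g↓ h↓ k≤m hₖ≉0
            d , Id , d∣g₁ , d∣h = common-divisor-bounded m (suc k) _ h g₁↓ h↓ (I-+* g h q Ig Ih) Ih
        in d , Id , ∣-cancel q d∣g₁ d∣h , d∣h
      ...   | no  k≰m =
        let q , h₁↓ = cancel-leading {g = h} {h = g} h↓ g↓ (ℕₚ.<⇒≤ (ℕₚ.≰⇒> k≰m)) gₘ≉0
            d , Id , d∣g , d∣h₁ = common-divisor-bounded (suc m) k g _ g↓ h₁↓ Ig (I-+* h g q Ih Ig)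
        in d , Id , d∣g , ∣-cancel q d∣h₁ d∣g

    common-divisor-in : ∀ g h → I g → I h → CommonDivisorIn g h
    common-divisor-in g h =
      common-divisor-bounded (length g) (length h) g h (vanishesFrom-length g) (vanishesFrom-length h)

module WieferichConditions
  (q d : ℕ) (K : FiniteField q) (L : FiniteField (q ^ d))
  (ι : CommutativeRing.Carrier (FiniteField.ring K) → CommutativeRing.Carrier (FiniteField.ring L))
  (ι-isHom : IsRingHom K L ι)
  (℘ : Poly.Pol (FiniteField.ring K))
  (℘-monic : Poly.MonicOfDegree (FiniteField.ring K) d ℘)
  (℘-irreducible : Poly.Irreducible (FiniteField.ring K) ℘)
  (θ : CommutativeRing.Carrier (FiniteField.ring L))
  (℘[θ]≈0 : CommutativeRing._≈_ (FiniteField.ring L) (Poly.eval (FiniteField.ring L) (map ι ℘) θ)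
                                (CommutativeRing.0# (FiniteField.ring L)))
  where

  private
    module K = CommutativeRing (FiniteField.ring K)
    module L = CommutativeRing (FiniteField.ring L)
    module L[t] = Polynomials (FiniteField.ring L)
    module ι[t] = PolynomialMap (FiniteField.ring K) (FiniteField.ring L) ι ι-isHom
    module 𝔽K = FiniteFieldFacts K
    module 𝔽L = FiniteFieldFacts L
  open Poly (FiniteField.ring K)
  open Poly (FiniteField.ring L) using () renaming (tP to tᴸ; constP to constᴸ; _-P_ to _-ᴸ_; _*P_ to _*ᴸ_)
  open Polynomials (FiniteField.ring K)
  open import Algebra.Properties.Semiring.Mult K.semiring using (_×_; ×-assocˡ)
  open import Algebra.Properties.Semiring.Exp L.semiring using () renaming (_^_ to _^ᴸ_)
  open import Data.Nat using (z≤n; s≤s)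

  N : ℕ
  N = q ^ d

  at-θ : Pol → L.Carrier
  at-θ f = Poly.eval (FiniteField.ring L) (map ι f) θ

  at-θ-cong : ∀ {f g} → f ≋ g → at-θ f L.≈ at-θ g
  at-θ-cong f≋g = L[t].eval-cong θ (ι[t].map-cong f≋g)

  at-θ-+P : ∀ f g → at-θ (f +P g) L.≈ at-θ f L.+ at-θ g
  at-θ-+P f g = L.trans (L[t].eval-cong θ (ι[t].map-+P f g)) (L[t].eval-+P (map ι f) (map ι g) θ)

  at-θ-*P : ∀ f g → at-θ (f *P g) L.≈ at-θ f L.* at-θ g
  at-θ-*P f g = L.trans (L[t].eval-cong θ (ι[t].map-*P f g)) (L[t].eval-*P (map ι f) (map ι g) θ)

  at-θ--P : ∀ f → at-θ (-P f) L.≈ L.- at-θ f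
  at-θ--P f = L.trans (L[t].eval-cong θ (ι[t].map--P f)) (L[t].eval--P (map ι f) θ)

  at-θ-^P : ∀ f k → at-θ (f ^P k) L.≈ at-θ f ^ᴸ k
  at-θ-^P f k = L.trans (L[t].eval-cong θ (ι[t].map-^P f k)) (L[t].eval-^P (map ι f) k θ)

  at-θ-oneP : at-θ oneP L.≈ L.1#
  at-θ-oneP = L.trans (L[t].eval-cong θ ι[t].map-oneP) (L[t].eval-constP L.1# θ)

  VanishesAtθ : Pol → Set
  VanishesAtθ f = at-θ f L.≈ L.0#

  ℘∣⇒vanishesAtθ : ∀ {f} → ℘ ∣ f → VanishesAtθ f
  ℘∣⇒vanishesAtθ (h , h℘≋f) = L.trans (L.sym (at-θ-cong h℘≋f))
    (L.trans (at-θ-*P h ℘) (L.trans (L.*-congˡ ℘[θ]≈0) (L.zeroʳ _)))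

  private
    module 𝔼 = EuclideanAlgorithm (FiniteField.ring K) 𝔽K._≟_ (FiniteField.inverse K)

    vanishesAtθ-+*P : ∀ g h k → VanishesAtθ g → VanishesAtθ h → VanishesAtθ (g +P k *P h)
    vanishesAtθ-+*P g h k g[θ]≈0 h[θ]≈0 = L.trans (at-θ-+P g (k *P h))
      (L.trans (L.+-cong g[θ]≈0 (L.trans (at-θ-*P k h) (L.trans (L.*-congˡ h[θ]≈0) (L.zeroʳ _))))
               (L.+-identityʳ L.0#))

    unit⇒¬vanishesAtθ : ∀ e → IsUnitP e → ¬ VanishesAtθ e
    unit⇒¬vanishesAtθ e (u , eu≈1) e[θ]≈0 = FiniteField.0≉1 L (begin
      L.0#                  ≈⟨ L.zeroˡ _ ⟨
      L.0# L.* at-θ u       ≈⟨ L.*-congʳ e[θ]≈0 ⟨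
      at-θ e L.* at-θ u     ≈⟨ at-θ-*P e u ⟨
      at-θ (e *P u)         ≈⟨ at-θ-cong {e *P u} {oneP} (coeffwise eu≈1) ⟩
      at-θ oneP             ≈⟨ at-θ-oneP ⟩
      L.1#                  ∎)
      where
      open Relation.Binary.Reasoning.Setoid L.setoid

    associate-∣ : ∀ w {e} → IsUnitP w → w *P e ≋ ℘ → ℘ ∣ e
    associate-∣ w {e} (u , wu≈1) we≋℘ = u , (begin
      u *P ℘              ≈⟨ *P-congʳ u we≋℘ ⟨
      u *P (w *P e)       ≈⟨ solve 3 (λ u w e → u :* (w :* e) := (w :* u) :* e) ≋-refl u w e ⟩
      (w *P u) *P e       ≈⟨ *P-congˡ e (coeffwise {w *P u} {oneP} wu≈1) ⟩
      oneP *P e           ≈⟨ *P-identityˡ e ⟩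
      e                   ∎)
      where
      open ≋-Reasoning
      open P-Solver using (solve; _:*_; _:=_)

  -- ℘ is the minimal polynomial of θ: a common divisor of ℘ and f that vanishes at θ is
  -- no unit, so by irreducibility it is an associate of ℘.
  vanishesAtθ⇒℘∣ : ∀ {f} → VanishesAtθ f → ℘ ∣ f
  vanishesAtθ⇒℘∣ {f} f[θ]≈0
    with 𝔼.common-divisor-in VanishesAtθ vanishesAtθ-+*P ℘ f ℘[θ]≈0 f[θ]≈0
  ... | e , e[θ]≈0 , (w , we≋℘) , e∣f with proj₂ (proj₂ ℘-irreducible) w e (coeff-≈ we≋℘)
  ...   | inj₁ w-unit = ∣ʳ-trans (associate-∣ w w-unit we≋℘) e∣f
  ...   | inj₂ e-unit = ⊥-elim (unit⇒¬vanishesAtθ e e-unit e[θ]≈0)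

  private
    monic-degree-0⇒≋1 : ∀ {p} → MonicOfDegree 0 p → p ≋ oneP
    monic-degree-0⇒≋1 (p₀≈1 , p↓) = coeffwise λ { zero → p₀≈1 ; (suc n) → p↓ (suc n) (s≤s z≤n) }

  d≢0 : d ≢ 0
  d≢0 d≡0 = proj₁ (proj₂ ℘-irreducible) (oneP , coeff-≈ (≋-trans (*P-identityʳ ℘) ℘≋1))
    where
    ℘≋1 : ℘ ≋ oneP
    ℘≋1 = monic-degree-0⇒≋1 (≡.subst (λ k → MonicOfDegree k ℘) d≡0 ℘-monic)

  q^k×x≈0 : ∀ k x → k ≢ 0 → (q ^ k) × x K.≈ K.0#
  q^k×x≈0 zero    x k≢0 = ⊥-elim (k≢0 ≡.refl)
  q^k×x≈0 (suc k) x _   = K.trans (K.sym (×-assocˡ x q (q ^ k))) (𝔽K.n×x≈0 _)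

  deriv-frobenius : ∀ f → deriv (f ^P N -P f) ≋ -P deriv f
  deriv-frobenius f = ≋-trans (deriv-+P (f ^P N) (-P f)) (+P-cong deriv-fᴺ≋0 (deriv--P f))
    where
    deriv-fᴺ≋0 : deriv (f ^P N) ≋ []
    deriv-fᴺ≋0 = deriv-^P≋0 f N (q^k×x≈0 d K.1# d≢0)

  ℘∣frobenius : ∀ f → ℘ ∣ f ^P N -P f
  ℘∣frobenius f = vanishesAtθ⇒℘∣ (L.trans (at-θ-+P (f ^P N) (-P f))
    (L.trans (L.+-cong (L.trans (at-θ-^P f N) (𝔽L.^n≈id _)) (at-θ--P f)) (L.-‿inverseʳ _)))

  open _∣ʳ_ (℘∣frobenius tP) renaming (quotient to g; equality to g℘≋tᴺ-t)

  g'℘+g℘'≋-1 : deriv g *P ℘ +P g *P deriv ℘ ≋ -P oneP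
  g'℘+g℘'≋-1 = begin
    deriv g *P ℘ +P g *P deriv ℘   ≈⟨ deriv-*P g ℘ ⟨
    deriv (g *P ℘)                 ≈⟨ deriv-cong g℘≋tᴺ-t ⟩
    deriv (tP ^P N -P tP)          ≈⟨ deriv-frobenius tP ⟩
    -P deriv tP                    ≈⟨ -P-cong deriv-tP ⟩
    -P oneP                        ∎
    where
    open ≋-Reasoning

  module Conditions (a : Pol) where
    open Setting q d K L ι ℘ θ a
      using (IsFermatQuotient; Cond0; Cond-i; Cond-i'; Cond-ii; Cond-ii'; IsDiffQuotient; Cond-iii)
    open P-Solver using (solve; _:+_; _:*_; :-_; _:-_; _:=_; con)
    open ≋-Reasoning
    open import Data.Integer using (+_)

    F : Pol
    F = a ^P N -P a

    fermatQuotient-≋ : ∀ {Q} → IsFermatQuotient Q → ℘ *P Q ≋ F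
    fermatQuotient-≋ {Q} = coeffwise {℘ *P Q} {F}

    fermatQuotient : Σ Pol IsFermatQuotient
    fermatQuotient = let Q , Q℘≋F = ℘∣frobenius a in Q , coeff-≈ (≋-trans (*P-comm ℘ Q) Q℘≋F)

    ℘'Q+℘Q'≋-a' : ∀ Q → IsFermatQuotient Q → deriv ℘ *P Q +P ℘ *P deriv Q ≋ -P deriv a
    ℘'Q+℘Q'≋-a' Q ℘Q≈F = begin
      deriv ℘ *P Q +P ℘ *P deriv Q   ≈⟨ deriv-*P ℘ Q ⟨
      deriv (℘ *P Q)                 ≈⟨ deriv-cong (fermatQuotient-≋ ℘Q≈F) ⟩
      deriv F                        ≈⟨ deriv-frobenius a ⟩
      -P deriv a                     ∎

    ℘∣Q⇒℘∣a' : ∀ Q → IsFermatQuotient Q → ℘ ∣ Q → ℘ ∣ deriv a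
    ℘∣Q⇒℘∣a' Q ℘Q≈F ℘∣Q = ∣ʳ-respʳ-≈ (solve 1 (λ a' → :- (:- a') := a') ≋-refl (deriv a))
      (∣--P (∣ʳ-respʳ-≈ (℘'Q+℘Q'≋-a' Q ℘Q≈F)
        (∣-+P (x∣ʳy⇒x∣ʳzy (deriv ℘) ℘∣Q) (x∣xy ℘ (deriv Q)))))

    ℘∣a'⇒℘∣Q : ∀ Q → IsFermatQuotient Q → ℘ ∣ deriv a → ℘ ∣ Q
    ℘∣a'⇒℘∣Q Q ℘Q≈F ℘∣a' = ∣ʳ-respʳ-≈ (≋-sym Q≋ga'+℘X) (∣-+P (x∣ʳy⇒x∣ʳzy g ℘∣a') (x∣xy ℘ X))
      where
      X = g *P deriv Q -P Q *P deriv g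
      Q≋ga'+℘X : Q ≋ g *P deriv a +P ℘ *P X
      Q≋ga'+℘X = begin
        Q
          ≈⟨ solve 1 (λ Q → Q := :- (Q :* (:- con (+ 1)))) ≋-refl Q ⟩
        -P (Q *P -P oneP)
          ≈⟨ -P-cong (*P-congʳ Q g'℘+g℘'≋-1) ⟨
        -P (Q *P (deriv g *P ℘ +P g *P deriv ℘))
          ≈⟨ solve 6 (λ Q g' ℘ g ℘' Q' →
               :- (Q :* (g' :* ℘ :+ g :* ℘')) := :- (g :* (℘' :* Q :+ ℘ :* Q')) :+ ℘ :* (g :* Q' :- Q :* g'))
               ≋-refl Q (deriv g) ℘ g (deriv ℘) (deriv Q) ⟩
        -P (g *P (deriv ℘ *P Q +P ℘ *P deriv Q)) +P ℘ *P X
          ≈⟨ +P-cong (-P-cong (*P-congʳ g (℘'Q+℘Q'≋-a' Q ℘Q≈F))) ≋-refl ⟩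
        -P (g *P -P deriv a) +P ℘ *P X
          ≈⟨ +P-cong (solve 2 (λ g a' → :- (g :* (:- a')) := g :* a') ≋-refl g (deriv a)) ≋-refl ⟩
        g *P deriv a +P ℘ *P X
          ∎

    wieferich⇒℘∣a' : Cond0 → Cond-i
    wieferich⇒℘∣a' (w , ℘℘w≈F) = ∣⇒∣P {℘} {deriv a} (℘∣Q⇒℘∣a' (℘ *P w) (coeff-≈ ℘[℘w]≋F) (x∣xy ℘ w))
      where
      ℘[℘w]≋F : ℘ *P (℘ *P w) ≋ F
      ℘[℘w]≋F = ≋-trans (≋-sym (*P-assoc ℘ ℘ w)) (coeffwise {(℘ *P ℘) *P w} {F} ℘℘w≈F)

    ℘∣a'⇒wieferich : Cond-i → Cond0
    ℘∣a'⇒wieferich ℘∣a' = v , coeff-≈ ℘℘v≋F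
      where
      Q₀ = proj₁ fermatQuotient
      ℘Q₀≈F = proj₂ fermatQuotient
      open _∣ʳ_ (℘∣a'⇒℘∣Q Q₀ ℘Q₀≈F (∣P⇒∣ {℘} {deriv a} ℘∣a')) renaming (quotient to v; equality to v℘≋Q₀)
      ℘℘v≋F : (℘ *P ℘) *P v ≋ F
      ℘℘v≋F = begin
        (℘ *P ℘) *P v   ≈⟨ solve 2 (λ ℘ v → (℘ :* ℘) :* v := ℘ :* (v :* ℘)) ≋-refl ℘ v ⟩
        ℘ *P (v *P ℘)   ≈⟨ *P-congʳ ℘ v℘≋Q₀ ⟩
        ℘ *P Q₀         ≈⟨ fermatQuotient-≋ ℘Q₀≈F ⟩
        F               ∎

    cond0⇔cond-i : Cond0 ⇔ Cond-i
    cond0⇔cond-i = mk⇔ wieferich⇒℘∣a' ℘∣a'⇒wieferich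

    cond-i⇔cond-i' : Cond-i ⇔ Cond-i'
    cond-i⇔cond-i' = mk⇔ (λ ℘∣a' → ℘∣⇒vanishesAtθ (∣P⇒∣ {℘} {deriv a} ℘∣a'))
                         (λ a'[θ]≈0 → ∣⇒∣P (vanishesAtθ⇒℘∣ {deriv a} a'[θ]≈0))

    cond-i⇔cond-ii : Cond-i ⇔ Cond-ii
    cond-i⇔cond-ii = mk⇔ (λ ℘∣a' Q ℘Q≈F → ∣⇒∣P (℘∣a'⇒℘∣Q Q ℘Q≈F (∣P⇒∣ {℘} {deriv a} ℘∣a')))
                         (λ ii → let Q₀ , ℘Q₀≈F = fermatQuotient
                                 in ∣⇒∣P (℘∣Q⇒℘∣a' Q₀ ℘Q₀≈F (∣P⇒∣ {℘} {Q₀} (ii Q₀ ℘Q₀≈F))))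

    cond-ii⇔cond-ii' : Cond-ii ⇔ Cond-ii'
    cond-ii⇔cond-ii' = mk⇔ (λ ii Q ℘Q≈F → ℘∣⇒vanishesAtθ (∣P⇒∣ {℘} {Q} (ii Q ℘Q≈F)))
                           (λ ii' Q ℘Q≈F → ∣⇒∣P (vanishesAtθ⇒℘∣ {Q} (ii' Q ℘Q≈F)))

    diffQuotient[θ]≈a'[θ] : ∀ a₁ → IsDiffQuotient a₁ → Poly.eval (FiniteField.ring L) a₁ θ L.≈ at-θ (deriv a)
    diffQuotient[θ]≈a'[θ] a₁ a₁-quot = L.trans
      (L[t].eval-quotient-by-linear (L[t].coeffwise {(tᴸ -ᴸ constᴸ θ) *ᴸ a₁} {map ι a -ᴸ constᴸ (at-θ a)} a₁-quot))
      (L[t].eval-cong θ (L[t].≋-sym (ι[t].map-deriv a)))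

    cond-i'⇔cond-iii : Cond-i' ⇔ Cond-iii
    cond-i'⇔cond-iii = mk⇔ (λ a'[θ]≈0 a₁ a₁-quot → L.trans (diffQuotient[θ]≈a'[θ] a₁ a₁-quot) a'[θ]≈0)
                           (λ iii → L.trans (L.sym (diffQuotient[θ]≈a'[θ] a₁ a₁-quot)) (iii a₁ a₁-quot))
      where
      a₁ = L[t].syntheticQuotient θ (map ι a)
      a₁-quot : IsDiffQuotient a₁
      a₁-quot = L[t].coeff-≈ (L[t].synthetic-division θ (map ι a))

theorem1 : (p n q d : ℕ) → Prime p → q ≡ p ^ n
    → (K : FiniteField q) → (L : FiniteField (q ^ d))
    → (ι : CommutativeRing.Carrier (FiniteField.ring K)
         → CommutativeRing.Carrier (FiniteField.ring L))
    → IsRingHom K L ι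
    → (℘ : Poly.Pol (FiniteField.ring K))
    → Poly.MonicOfDegree (FiniteField.ring K) d ℘
    → Poly.Irreducible (FiniteField.ring K) ℘
    → (θ : CommutativeRing.Carrier (FiniteField.ring L))
    → CommutativeRing._≈_ (FiniteField.ring L)
        (Poly.eval (FiniteField.ring L) (map ι ℘) θ)
        (CommutativeRing.0# (FiniteField.ring L))
    → (a : Poly.Pol (FiniteField.ring K))
    → Setting.AllEquivalent q d K L ι ℘ θ a
theorem1 _ _ q d _ _ K L ι ι-isHom ℘ ℘-monic ℘-irreducible θ ℘[θ]≈0 a =
  cond0⇔cond-i ,
  ⇔-trans cond0⇔cond-i cond-i⇔cond-i' ,
  ⇔-trans cond0⇔cond-i cond-i⇔cond-ii ,
  ⇔-trans cond0⇔cond-i (⇔-trans cond-i⇔cond-ii cond-ii⇔cond-ii') ,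
  ⇔-trans cond0⇔cond-i (⇔-trans cond-i⇔cond-i' cond-i'⇔cond-iii)
  where
  open WieferichConditions q d K L ι ι-isHom ℘ ℘-monic ℘-irreducible θ ℘[θ]≈0 using (module Conditions)
  open Conditions a
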